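{- Let $T$ be a tournament with $n$ vertices, let $\delta_T$ denote the number of diamonds in $T$, and let $S$ be the Seidel adjacency matrix of $T$. Then: (1) If $n$ is even, then $\delta_T\leq \frac{1}{96}n^2(n-1)(n-2)$, and equality holds if and only if $n\equiv 0\pmod 4$ and $S$ is a skew-conference matrix. (2) If $n$ is odd, then $\delta_T\leq \frac{1}{96}n(n-1)(n-3)(n+1)$, and equality holds if and only if $n\equiv 3\pmod 4$ and $S$ is obtained by deleting a row and the corresponding column from a skew-conference matrix (of order $n+1$).
   Context: A tournament on vertices $v_1,\dots,v_n$ has adjacency matrix $A=(a_{ij})$ with $a_{ij}=1$ if $v_i$ dominates $v_j$ and $0$ otherwise; its Seidel adjacency matrix is $S=A-A^T$. A diamond is a 4-vertex tournament containing exactly one directed 3-cycle (equivalently, a vertex dominating, or dominated by, a 3-cycle); $\delta_T$ is the number of 4-element vertex subsets of $T$ inducing a diamond. A skew-conference matrix of order $m$ is an $m\times m$ matrix $C$ with zero diagonal, off-diagonal entries in $\{ -1,1\}$, $C^T=-C$, and $CC^T=(m-1)I_m$. -}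

module Defs where

open import Data.Nat using (ℕ; zero; suc; _+_; _*_; _<_; _∸_; _<?_)
open import Data.Fin using (Fin; toℕ; punchIn; _≟_)
open import Relation.Nullary.Decidable using (⌊_⌋)
import Data.Fin as Fin
open import Data.Bool using (Bool; true; false; _∧_; _∨_; T; if_then_else_)
open import Data.Integer as ℤ using (ℤ)
open import Data.Product using (_×_; Σ)
open import Data.Sum using (_⊎_)
open import Relation.Binary.PropositionalEquality using (_≡_; _≢_)

sumℕ : ∀ {n} → (Fin n → ℕ) → ℕ
sumℕ {zero}  f = 0
sumℕ {suc n} f = f Fin.zero + sumℕ (λ i → f (Fin.suc i))

sumℤ : ∀ {n} → (Fin n → ℤ) → ℤ
sumℤ {zero}  f = ℤ.0ℤ
sumℤ {suc n} f = f Fin.zero ℤ.+ sumℤ (λ i → f (Fin.suc i))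

-- A tournament on vertex set Fin n: a i j = true iff v_i dominates v_j.
record Tournament (n : ℕ) : Set where
  field
    adj      : Fin n → Fin n → Bool
    irrefl   : ∀ i → adj i i ≡ false
    tot      : ∀ i j → i ≢ j → T (adj i j ∨ adj j i)
    antisym  : ∀ i j → T (adj i j) → adj j i ≡ false
open Tournament public

adjMatrix : ∀ {n} → Tournament n → Fin n → Fin n → ℤ
adjMatrix t i j = if adj t i j then ℤ.1ℤ else ℤ.0ℤ

seidel : ∀ {n} → Tournament n → Fin n → Fin n → ℤ
seidel t i j = adjMatrix t i j ℤ.- adjMatrix t j i

cyclic : ∀ {n} → Tournament n → Fin n → Fin n → Fin n → Bool
cyclic t i j k = (adj t i j ∧ adj t j k ∧ adj t k i) ∨ (adj t j i ∧ adj t k j ∧ adj t i k)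

b2n : Bool → ℕ
b2n true  = 1
b2n false = 0

cyclesIn4 : ∀ {n} → Tournament n → Fin n → Fin n → Fin n → Fin n → ℕ
cyclesIn4 t i j k l =
  b2n (cyclic t i j k) + b2n (cyclic t i j l) + b2n (cyclic t i k l) + b2n (cyclic t j k l)

isDiamond : ∀ {n} → Tournament n → Fin n → Fin n → Fin n → Fin n → Bool
isDiamond t i j k l with cyclesIn4 t i j k l
... | 1 = true
... | _ = false

ltB : ℕ → ℕ → Bool
ltB m n = ⌊ m <? n ⌋

diamonds : ∀ {n} → Tournament n → ℕ
diamonds {n} t =
  sumℕ λ i → sumℕ λ j → sumℕ λ k → sumℕ λ l →
    b2n (ltB (toℕ i) (toℕ j) ∧ ltB (toℕ j) (toℕ k) ∧ ltB (toℕ k) (toℕ l) ∧ isDiamond t i j k l)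

record IsSkewConference (m : ℕ) (C : Fin m → Fin m → ℤ) : Set where
  field
    diag0   : ∀ i → C i i ≡ ℤ.0ℤ
    offdiag : ∀ i j → i ≢ j → (C i j ≡ ℤ.1ℤ) ⊎ (C i j ≡ ℤ.-1ℤ)
    skew    : ∀ i j → C j i ≡ ℤ.- C i j
    orth    : ∀ i j → sumℤ (λ k → C i k ℤ.* C j k)
                ≡ (if ⌊ i ≟ j ⌋ then ℤ.+ (m ∸ 1) else ℤ.0ℤ)

DeletedSkewConference : (n : ℕ) → (Fin n → Fin n → ℤ) → Set
DeletedSkewConference n S =
  Σ (Fin (suc n) → Fin (suc n) → ℤ) λ C → IsSkewConference (suc n) C ×
    Σ (Fin (suc n)) λ r → ∀ i j → S i j ≡ C (punchIn r i) (punchIn r j)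

{-# OPTIONS --safe #-}

-- Let S be the Seidel matrix and M = S Sᵀ its Gram matrix, so Σ_{i≠j} M_ij² is the sum of
-- s_ik s_jk s_il s_jl over all quadruples with i ≠ j. Those with k = l contribute n(n-1)(n-2);
-- on a 4-set the three pairings {ij|kl}, {ik|jl}, {il|jk} give products summing to
-- 1 - 4[the 4-set is a diamond] (checked on all 64 tournaments of order 4), and every 4-set
-- occurs 24 times among the ordered quadruples. Hence
--   96 δ_T + 3 Σ_{i≠j} M_ij² = n²(n-1)(n-2).
-- The even bound is Σ M_ij² ≥ 0, with equality iff M = (n-1) I, i.e. S is skew-conference;
-- three rows of the ±1 matrix S + I then force n ≡ 0 (mod 4).
-- For odd n every M_ij (i ≠ j) is odd, so Σ (M_ij² - 1) ≥ 0 gives the odd bound. Equality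
-- means M_ij = ±1, and counting modulo 4 makes M_ij M_ik M_jk a constant ε determined by
-- n mod 4, so M = (n-1-ε) I + ε x xᵀ for a ±1 vector x. Then S x is an eigenvector of M for
-- both n-1-ε and n-1-ε+εn, so S x = 0; this forces ε = -1, i.e. n ≡ 3 (mod 4), and bordering
-- S by x gives a skew-conference matrix of order n + 1.

module Submission where

open import Data.Bool using (Bool; true; false; T; not; _∧_; _∨_; if_then_else_)
open import Data.Empty using (⊥-elim)
open import Data.Fin using (Fin; zero; suc; toℕ; punchIn; _≟_)
open import Data.Nat using (ℕ; zero; suc)
open import Data.Product using (∃; _×_; _,_; proj₁; proj₂)
open import Data.Sum using (_⊎_; inj₁; inj₂)
open import Function using (_∘_)
open import Relation.Binary.PropositionalEquality
open import Relation.Nullary using (¬_; yes; no)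
open import Relation.Nullary.Decidable using (⌊_⌋)

open import Defs

cong₃ : ∀ {A B C D : Set} (f : A → B → C → D) {x x′ y y′ z z′} → x ≡ x′ → y ≡ y′ → z ≡ z′ → f x y z ≡ f x′ y′ z′
cong₃ f refl refl refl = refl

module Sums where

  open import Data.Integer using (ℤ; +_; 0ℤ; 1ℤ; -1ℤ; _+_; _*_; -_; _-_)
  open import Data.Integer.Properties
    using (+-*-semiring; pos-+; -1*i≡-i; *-identityˡ; *-identityʳ; +-identityʳ; *-assoc; *-zeroʳ)
  open import Data.Integer.Tactic.RingSolver using (solve-∀)
  open import Data.Fin.Properties using (punchInᵢ≢i)
  open import Algebra.Properties.Semiring.Sum +-*-semiring public
    using (sum; sum-cong-≗; ∑-distrib-+; ∑-comm; *-distribˡ-sum; *-distribʳ-sum; sum-replicate-zero; sum-remove)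

  sumℤ≡sum : ∀ {n} (f : Fin n → ℤ) → sumℤ f ≡ sum f
  sumℤ≡sum {zero}  f = refl
  sumℤ≡sum {suc n} f = cong (_+_ (f zero)) (sumℤ≡sum (f ∘ suc))

  sumℕ≡sum : ∀ {n} (f : Fin n → ℕ) → + sumℕ f ≡ sum (λ i → + f i)
  sumℕ≡sum {zero}  f = refl
  sumℕ≡sum {suc n} f = trans (pos-+ (f zero) (sumℕ (f ∘ suc))) (cong (_+_ (+ f zero)) (sumℕ≡sum (f ∘ suc)))

  sum-*ˡ : ∀ {n} c (f : Fin n → ℤ) → sum (λ i → c * f i) ≡ c * sum f
  sum-*ˡ c f = sym (*-distribˡ-sum c f)

  sum-*ʳ : ∀ {n} c (f : Fin n → ℤ) → sum (λ i → f i * c) ≡ sum f * c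
  sum-*ʳ c f = sym (*-distribʳ-sum c f)

  sum-neg : ∀ {n} (f : Fin n → ℤ) → sum (λ i → - f i) ≡ - sum f
  sum-neg f = trans (sum-cong-≗ (λ i → sym (-1*i≡-i (f i)))) (trans (sum-*ˡ -1ℤ f) (-1*i≡-i (sum f)))

  sum-− : ∀ {n} (f g : Fin n → ℤ) → sum (λ i → f i - g i) ≡ sum f - sum g
  sum-− f g = trans (∑-distrib-+ f (λ i → - g i)) (cong (_+_ (sum f)) (sum-neg g))

  sum-const : ∀ {n} c → sum {n} (λ _ → c) ≡ + n * c
  sum-const {zero}  c = refl
  sum-const {suc n} c = trans (cong (_+_ c) (sum-const {n} c)) (succ-* c (+ n))
    where
    succ-* : ∀ c m → c + m * c ≡ (1ℤ + m) * c
    succ-* = solve-∀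

  𝟙 : Bool → ℤ
  𝟙 b = if b then 1ℤ else 0ℤ

  δ : ∀ {n} → Fin n → Fin n → ℤ
  δ i j = 𝟙 ⌊ i ≟ j ⌋

  δᶜ : ∀ {n} → Fin n → Fin n → ℤ
  δᶜ i j = 1ℤ - δ i j

  δ-refl : ∀ {n} (i : Fin n) → δ i i ≡ 1ℤ
  δ-refl i with i ≟ i
  ... | yes _ = refl
  ... | no i≢i = ⊥-elim (i≢i refl)

  δ-≢ : ∀ {n} {i j : Fin n} → i ≢ j → δ i j ≡ 0ℤ
  δ-≢ {i = i} {j} i≢j with i ≟ j
  ... | yes i≡j = ⊥-elim (i≢j i≡j)
  ... | no _ = refl

  if-δ : ∀ {n} (i j : Fin n) c → (if ⌊ i ≟ j ⌋ then c else 0ℤ) ≡ δ i j * c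
  if-δ i j c with i ≟ j
  ... | yes _ = sym (*-identityˡ c)
  ... | no _ = refl

  δᶜ-refl : ∀ {n} (i : Fin n) → δᶜ i i ≡ 0ℤ
  δᶜ-refl i = cong (_-_ 1ℤ) (δ-refl i)

  δᶜ-≢ : ∀ {n} {i j : Fin n} → i ≢ j → δᶜ i j ≡ 1ℤ
  δᶜ-≢ i≢j = cong (_-_ 1ℤ) (δ-≢ i≢j)

  δᶜ-guard : ∀ {n} {i j : Fin n} {x y} → (i ≢ j → x ≡ y) → δᶜ i j * x ≡ δᶜ i j * y
  δᶜ-guard {i = i} {j} h with i ≟ j
  ... | yes _ = refl
  ... | no i≢j = cong (1ℤ *_) (h i≢j)

  δ-sym : ∀ {n} (i j : Fin n) → δ i j ≡ δ j i
  δ-sym i j with i ≟ j | j ≟ i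
  ... | yes _ | yes _ = refl
  ... | no _ | no _ = refl
  ... | yes i≡j | no j≢i = ⊥-elim (j≢i (sym i≡j))
  ... | no i≢j | yes j≡i = ⊥-elim (i≢j (sym j≡i))

  δᶜ-sym : ∀ {n} (i j : Fin n) → δᶜ i j ≡ δᶜ j i
  δᶜ-sym i j = cong (_-_ 1ℤ) (δ-sym i j)

  δᶜ-idem : ∀ {n} (i j : Fin n) → δᶜ i j * δᶜ i j ≡ δᶜ i j
  δᶜ-idem i j with i ≟ j
  ... | yes _ = refl
  ... | no _ = refl

  sum-δ : ∀ {n} (i : Fin n) (f : Fin n → ℤ) → sum (λ j → δ i j * f j) ≡ f i
  sum-δ {suc n} i f = begin
      sum (λ j → δ i j * f j)
    ≡⟨ sum-remove {i = i} (λ j → δ i j * f j) ⟩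
      δ i i * f i + sum (λ j → δ i (punchIn i j) * f (punchIn i j))
    ≡⟨ cong₂ _+_ (cong (_* f i) (δ-refl i)) (sum-cong-≗ λ j → cong (_* f (punchIn i j)) (δ-≢ (punchInᵢ≢i i j ∘ sym))) ⟩
      1ℤ * f i + sum {n} (λ _ → 0ℤ)
    ≡⟨ cong₂ _+_ (*-identityˡ (f i)) (sum-replicate-zero n) ⟩
      f i + 0ℤ
    ≡⟨ +-identityʳ (f i) ⟩
      f i ∎
    where open ≡-Reasoning

  sum-δᶜ-* : ∀ {n} (i : Fin n) (f : Fin n → ℤ) → sum (λ j → δᶜ i j * f j) ≡ sum f - f i
  sum-δᶜ-* i f = trans (sum-cong-≗ λ j → distrib (δ i j) (f j)) (trans (sum-− f (λ j → δ i j * f j)) (cong (_-_ (sum f)) (sum-δ i f)))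
    where
    distrib : ∀ d x → (1ℤ - d) * x ≡ x - d * x
    distrib = solve-∀

  sum-δᶜ : ∀ {n} (i : Fin n) → sum (δᶜ i) ≡ + n - 1ℤ
  sum-δᶜ {n} i = begin
    sum (δᶜ i)                     ≡⟨ sum-cong-≗ (λ j → sym (*-identityʳ (δᶜ i j))) ⟩
    sum (λ j → δᶜ i j * 1ℤ)        ≡⟨ sum-δᶜ-* i (λ _ → 1ℤ) ⟩
    sum {n} (λ _ → 1ℤ) - 1ℤ        ≡⟨ cong (_- 1ℤ) (trans (sum-const {n} 1ℤ) (*-identityʳ (+ n))) ⟩
    + n - 1ℤ                       ∎
    where open ≡-Reasoning

  distinct₃ : ∀ {n} → Fin n → Fin n → Fin n → ℤ
  distinct₃ i j k = δᶜ i j * δᶜ i k * δᶜ j k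

  distinct₄ : ∀ {n} → Fin n → Fin n → Fin n → Fin n → ℤ
  distinct₄ i j k l = distinct₃ i j k * (δᶜ i l * δᶜ j l * δᶜ k l)

  distinct₄-guard : ∀ {n} {i j k l : Fin n} {x y} →
    (i ≢ j → i ≢ k → j ≢ k → i ≢ l → j ≢ l → k ≢ l → x ≡ y) →
    distinct₄ i j k l * x ≡ distinct₄ i j k l * y
  distinct₄-guard {i = i} {j} {k} {l} {x} {y} h = begin
      distinct₄ i j k l * x
    ≡⟨ nest (δᶜ i j) (δᶜ i k) (δᶜ j k) (δᶜ i l) (δᶜ j l) (δᶜ k l) x ⟩
      δᶜ i j * (δᶜ i k * (δᶜ j k * (δᶜ i l * (δᶜ j l * (δᶜ k l * x)))))
    ≡⟨ (δᶜ-guard λ p₁ → δᶜ-guard λ p₂ → δᶜ-guard λ p₃ → δᶜ-guard λ p₄ → δᶜ-guard λ p₅ → δᶜ-guard λ p₆ →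
         h p₁ p₂ p₃ p₄ p₅ p₆) ⟩
      δᶜ i j * (δᶜ i k * (δᶜ j k * (δᶜ i l * (δᶜ j l * (δᶜ k l * y)))))
    ≡⟨ sym (nest (δᶜ i j) (δᶜ i k) (δᶜ j k) (δᶜ i l) (δᶜ j l) (δᶜ k l) y) ⟩
      distinct₄ i j k l * y ∎
    where
    open ≡-Reasoning
    nest : ∀ a b c d e f x → a * b * c * (d * e * f) * x ≡ a * (b * (c * (d * (e * (f * x)))))
    nest = solve-∀

  distinct₄-≢ : ∀ {n} {i j k l : Fin n} → i ≢ j → i ≢ k → j ≢ k → i ≢ l → j ≢ l → k ≢ l → distinct₄ i j k l ≡ 1ℤ
  distinct₄-≢ p₁ p₂ p₃ p₄ p₅ p₆ rewrite δᶜ-≢ p₁ | δᶜ-≢ p₂ | δᶜ-≢ p₃ | δᶜ-≢ p₄ | δᶜ-≢ p₅ | δᶜ-≢ p₆ = refl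

  distinct₄-swap₁₂ : ∀ {n} (i j k l : Fin n) → distinct₄ j i k l ≡ distinct₄ i j k l
  distinct₄-swap₁₂ i j k l rewrite δᶜ-sym j i = reorder (δᶜ i j) (δᶜ j k) (δᶜ i k) (δᶜ j l) (δᶜ i l) (δᶜ k l)
    where
    reorder : ∀ a b c d e f → a * b * c * (d * e * f) ≡ a * c * b * (e * d * f)
    reorder = solve-∀

  distinct₄-swap₂₃ : ∀ {n} (i j k l : Fin n) → distinct₄ i k j l ≡ distinct₄ i j k l
  distinct₄-swap₂₃ i j k l rewrite δᶜ-sym k j = reorder (δᶜ i k) (δᶜ i j) (δᶜ j k) (δᶜ i l) (δᶜ k l) (δᶜ j l)
    where
    reorder : ∀ a b c d e f → a * b * c * (d * e * f) ≡ b * a * c * (d * f * e)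
    reorder = solve-∀

  distinct₄-swap₃₄ : ∀ {n} (i j k l : Fin n) → distinct₄ i j l k ≡ distinct₄ i j k l
  distinct₄-swap₃₄ i j k l rewrite δᶜ-sym l k = reorder (δᶜ i j) (δᶜ i l) (δᶜ j l) (δᶜ i k) (δᶜ j k) (δᶜ k l)
    where
    reorder : ∀ a b c d e f → a * b * c * (d * e * f) ≡ a * d * e * (b * c * f)
    reorder = solve-∀

  sum⁴ : ∀ {n} → (Fin n → Fin n → Fin n → Fin n → ℤ) → ℤ
  sum⁴ F = sum λ i → sum λ j → sum λ k → sum λ l → F i j k l

  sum⁴-cong : ∀ {n} {F G : Fin n → Fin n → Fin n → Fin n → ℤ} →
    (∀ i j k l → F i j k l ≡ G i j k l) → sum⁴ F ≡ sum⁴ G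
  sum⁴-cong F≡G = sum-cong-≗ λ i → sum-cong-≗ λ j → sum-cong-≗ λ k → sum-cong-≗ λ l → F≡G i j k l

  sum⁴-+ : ∀ {n} (F G : Fin n → Fin n → Fin n → Fin n → ℤ) →
    sum⁴ (λ i j k l → F i j k l + G i j k l) ≡ sum⁴ F + sum⁴ G
  sum⁴-+ F G =
    trans (sum-cong-≗ λ i →
      trans (sum-cong-≗ λ j →
        trans (sum-cong-≗ λ k → ∑-distrib-+ (F i j k) (G i j k))
              (∑-distrib-+ (λ k → sum (F i j k)) (λ k → sum (G i j k))))
            (∑-distrib-+ (λ j → sum λ k → sum (F i j k)) (λ j → sum λ k → sum (G i j k))))
      (∑-distrib-+ (λ i → sum λ j → sum λ k → sum (F i j k)) (λ i → sum λ j → sum λ k → sum (G i j k)))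

  sum⁴-*ˡ : ∀ {n} c (F : Fin n → Fin n → Fin n → Fin n → ℤ) → sum⁴ (λ i j k l → c * F i j k l) ≡ c * sum⁴ F
  sum⁴-*ˡ c F =
    trans (sum-cong-≗ λ i →
      trans (sum-cong-≗ λ j →
        trans (sum-cong-≗ λ k → sum-*ˡ c (F i j k))
              (sum-*ˡ c (λ k → sum (F i j k))))
            (sum-*ˡ c (λ j → sum λ k → sum (F i j k))))
      (sum-*ˡ c (λ i → sum λ j → sum λ k → sum (F i j k)))

  sum⁴-swap₁₂ : ∀ {n} (F : Fin n → Fin n → Fin n → Fin n → ℤ) → sum⁴ F ≡ sum⁴ (λ i j k l → F j i k l)
  sum⁴-swap₁₂ F = ∑-comm (λ i j → sum λ k → sum λ l → F i j k l)

  sum⁴-swap₂₃ : ∀ {n} (F : Fin n → Fin n → Fin n → Fin n → ℤ) → sum⁴ F ≡ sum⁴ (λ i j k l → F i k j l)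
  sum⁴-swap₂₃ F = sum-cong-≗ λ i → ∑-comm (λ j k → sum λ l → F i j k l)

  sum⁴-swap₃₄ : ∀ {n} (F : Fin n → Fin n → Fin n → Fin n → ℤ) → sum⁴ F ≡ sum⁴ (λ i j k l → F i j l k)
  sum⁴-swap₃₄ F = sum-cong-≗ λ i → sum-cong-≗ λ j → ∑-comm (λ k l → F i j k l)

  sum⁴-rotate₁₂₃ : ∀ {n} (F : Fin n → Fin n → Fin n → Fin n → ℤ) → sum⁴ F ≡ sum⁴ (λ i j k l → F j k i l)
  sum⁴-rotate₁₂₃ F = trans (sum⁴-swap₂₃ F) (sum⁴-swap₁₂ (λ i j k l → F i k j l))

  sum⁴-rotate₂₃₄ : ∀ {n} (F : Fin n → Fin n → Fin n → Fin n → ℤ) → sum⁴ F ≡ sum⁴ (λ i j k l → F i k l j)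
  sum⁴-rotate₂₃₄ F = trans (sum⁴-swap₃₄ F) (sum⁴-swap₂₃ (λ i j k l → F i j l k))

  sum⁴-rotate₁₂₃₄ : ∀ {n} (F : Fin n → Fin n → Fin n → Fin n → ℤ) → sum⁴ F ≡ sum⁴ (λ i j k l → F j k l i)
  sum⁴-rotate₁₂₃₄ F = trans (sum⁴-rotate₂₃₄ F) (sum⁴-swap₁₂ (λ i j k l → F i k l j))

  sum-distinct₃ : ∀ {n} (i j : Fin n) → sum (distinct₃ i j) ≡ δᶜ i j * (+ n - + 2)
  sum-distinct₃ {n} i j = begin
      sum (λ k → δᶜ i j * δᶜ i k * δᶜ j k)
    ≡⟨ sum-cong-≗ (λ k → *-assoc (δᶜ i j) (δᶜ i k) (δᶜ j k)) ⟩
      sum (λ k → δᶜ i j * (δᶜ i k * δᶜ j k))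
    ≡⟨ sum-*ˡ (δᶜ i j) (λ k → δᶜ i k * δᶜ j k) ⟩
      δᶜ i j * sum (λ k → δᶜ i k * δᶜ j k)
    ≡⟨ cong (δᶜ i j *_) (trans (sum-δᶜ-* i (δᶜ j)) (cong₂ _-_ (sum-δᶜ j) (δᶜ-sym j i))) ⟩
      δᶜ i j * (+ n - 1ℤ - δᶜ i j)
    ≡⟨ idempotent-shift (δᶜ i j) (+ n) (δᶜ-idem i j) ⟩
      δᶜ i j * (+ n - + 2) ∎
    where
    open ≡-Reasoning
    idempotent-shift : ∀ d N → d * d ≡ d → d * (N - 1ℤ - d) ≡ d * (N - + 2)
    idempotent-shift d N d²≡d = begin
      d * (N - 1ℤ - d)    ≡⟨ expand d N ⟩
      d * N - d - d * d   ≡⟨ cong (_-_ (d * N - d)) d²≡d ⟩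
      d * N - d - d       ≡⟨ collect d N ⟩
      d * (N - + 2)       ∎
      where
      expand : ∀ d N → d * (N - 1ℤ - d) ≡ d * N - d - d * d
      expand = solve-∀
      collect : ∀ d N → d * N - d - d ≡ d * (N - + 2)
      collect = solve-∀

  sum-distinct₄ : ∀ {n} (i j k : Fin n) → sum (distinct₄ i j k) ≡ distinct₃ i j k * (+ n - + 3)
  sum-distinct₄ {n} i j k = begin
      sum (λ l → distinct₃ i j k * (δᶜ i l * δᶜ j l * δᶜ k l))
    ≡⟨ sum-*ˡ (distinct₃ i j k) (λ l → δᶜ i l * δᶜ j l * δᶜ k l) ⟩
      distinct₃ i j k * sum (λ l → δᶜ i l * δᶜ j l * δᶜ k l)
    ≡⟨ cong (distinct₃ i j k *_) (trans (sum-cong-≗ λ l → *-assoc (δᶜ i l) (δᶜ j l) (δᶜ k l)) (sum-δᶜ-* i (λ l → δᶜ j l * δᶜ k l))) ⟩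
      distinct₃ i j k * (sum (λ l → δᶜ j l * δᶜ k l) - δᶜ j i * δᶜ k i)
    ≡⟨ cong (λ x → distinct₃ i j k * (x - δᶜ j i * δᶜ k i)) (trans (sum-δᶜ-* j (δᶜ k)) (cong (_-_ (sum (δᶜ k))) (δᶜ-sym k j))) ⟩
      distinct₃ i j k * (sum (δᶜ k) - δᶜ j k - δᶜ j i * δᶜ k i)
    ≡⟨ cong₂ (λ x y → distinct₃ i j k * (x - δᶜ j k - y)) (sum-δᶜ k) (cong₂ _*_ (δᶜ-sym j i) (δᶜ-sym k i)) ⟩
      distinct₃ i j k * (+ n - 1ℤ - δᶜ j k - δᶜ i j * δᶜ i k)
    ≡⟨ idempotent-shift (δᶜ i j) (δᶜ i k) (δᶜ j k) (δᶜ-idem i j) (δᶜ-idem i k) (δᶜ-idem j k) ⟩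
      distinct₃ i j k * (+ n - + 3) ∎
    where
    open ≡-Reasoning
    N : ℤ
    N = + n
    idempotent-shift : ∀ a b c → a * a ≡ a → b * b ≡ b → c * c ≡ c →
      a * b * c * (N - 1ℤ - c - a * b) ≡ a * b * c * (N - + 3)
    idempotent-shift a b c a²≡a b²≡b c²≡c = begin
        a * b * c * (N - 1ℤ - c - a * b)
      ≡⟨ expand a b c N ⟩
        a * b * c * N - a * b * c - a * b * (c * c) - (a * a) * (b * b) * c
      ≡⟨ cong₂ (λ x y → a * b * c * N - a * b * c - a * b * x - y * c) c²≡c (cong₂ _*_ a²≡a b²≡b) ⟩
        a * b * c * N - a * b * c - a * b * c - a * b * c
      ≡⟨ collect a b c N ⟩
        a * b * c * (N - + 3) ∎
      where
      expand : ∀ a b c N → a * b * c * (N - 1ℤ - c - a * b) ≡ a * b * c * N - a * b * c - a * b * (c * c) - (a * a) * (b * b) * c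
      expand = solve-∀
      collect : ∀ a b c N → a * b * c * N - a * b * c - a * b * c - a * b * c ≡ a * b * c * (N - + 3)
      collect = solve-∀

  sum⁴-distinct₄ : ∀ {n} → sum⁴ {n} distinct₄ ≡ + n * ((+ n - 1ℤ) * ((+ n - + 2) * (+ n - + 3)))
  sum⁴-distinct₄ {n} = begin
      sum⁴ {n} distinct₄
    ≡⟨ (sum-cong-≗ λ (i : Fin n) → sum-cong-≗ λ j →
         trans (sum-cong-≗ λ k → sum-distinct₄ i j k)
               (trans (sum-*ʳ (N - + 3) (distinct₃ i j)) (cong (_* (N - + 3)) (sum-distinct₃ i j)))) ⟩
      (sum λ (i : Fin n) → sum λ j → δᶜ i j * (N - + 2) * (N - + 3))
    ≡⟨ (sum-cong-≗ λ (i : Fin n) →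
         trans (sum-cong-≗ λ j → *-assoc (δᶜ i j) (N - + 2) (N - + 3))
               (trans (sum-*ʳ ((N - + 2) * (N - + 3)) (δᶜ i)) (cong (_* ((N - + 2) * (N - + 3))) (sum-δᶜ i)))) ⟩
      sum {n} (λ _ → (N - 1ℤ) * ((N - + 2) * (N - + 3)))
    ≡⟨ sum-const {n} _ ⟩
      N * ((N - 1ℤ) * ((N - + 2) * (N - + 3))) ∎
    where
    open ≡-Reasoning
    N : ℤ
    N = + n

  offdiag-sum : ∀ {n} → (Fin n → Fin n → ℤ) → ℤ
  offdiag-sum f = sum λ i → sum λ j → δᶜ i j * f i j

  offdiag-sum-vanishes : ∀ {n} {f : Fin n → Fin n → ℤ} → (∀ {i j} → i ≢ j → f i j ≡ 0ℤ) → offdiag-sum f ≡ 0ℤ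
  offdiag-sum-vanishes {n} h =
    trans (sum-cong-≗ λ i → trans (sum-cong-≗ λ j → trans (δᶜ-guard {i = i} {j} h) (*-zeroʳ (δᶜ i j))) (sum-replicate-zero n))
          (sum-replicate-zero n)

  offdiag-sum-pred : ∀ {n} (f : Fin n → Fin n → ℤ) → offdiag-sum (λ i j → f i j - 1ℤ) ≡ offdiag-sum f - + n * (+ n - 1ℤ)
  offdiag-sum-pred {n} f = begin
      offdiag-sum (λ i j → f i j - 1ℤ)
    ≡⟨ (sum-cong-≗ λ i → trans (sum-cong-≗ λ j → distrib (δᶜ i j) (f i j)) (sum-− (λ j → δᶜ i j * f i j) (δᶜ i))) ⟩
      sum (λ i → sum (λ j → δᶜ i j * f i j) - sum (δᶜ i))
    ≡⟨ sum-− (λ i → sum λ j → δᶜ i j * f i j) (λ i → sum (δᶜ i)) ⟩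
      offdiag-sum f - sum (λ (i : Fin n) → sum (δᶜ i))
    ≡⟨ cong (_-_ (offdiag-sum f)) (trans (sum-cong-≗ (λ (i : Fin n) → sum-δᶜ i)) (sum-const {n} (+ n - 1ℤ))) ⟩
      offdiag-sum f - + n * (+ n - 1ℤ) ∎
    where
    open ≡-Reasoning
    distrib : ∀ d x → d * (x - 1ℤ) ≡ d * x - d
    distrib = solve-∀

module Signs where

  open import Data.Integer using (ℤ; +_; -[1+_]; 0ℤ; 1ℤ; -1ℤ; _+_; _*_; -_)
  open import Data.Integer.Properties using (+-injective; pos-+; pos-*; +-assoc; *-identityˡ)
  open import Data.Integer.Tactic.RingSolver using (solve-∀)
  import Data.Nat as ℕ
  import Data.Nat.Properties as ℕ
  open Sums

  Nonneg : ℤ → Set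
  Nonneg z = ∃ λ k → z ≡ + k

  nonneg-+ : ∀ {a b} → Nonneg a → Nonneg b → Nonneg (a + b)
  nonneg-+ (k , refl) (l , refl) = k ℕ.+ l , sym (pos-+ k l)

  nonneg-square : ∀ z → Nonneg (z * z)
  nonneg-square (+ k)    = k ℕ.* k , sym (pos-* k k)
  nonneg-square -[1+ k ] = suc k ℕ.* suc k , refl

  nonneg-sum : ∀ {n} {f : Fin n → ℤ} → (∀ i → Nonneg (f i)) → Nonneg (sum f)
  nonneg-sum {zero}  _ = 0 , refl
  nonneg-sum {suc n} h = nonneg-+ (h zero) (nonneg-sum (h ∘ suc))

  nonneg-+-zero : ∀ {a b} → Nonneg a → Nonneg b → a + b ≡ 0ℤ → a ≡ 0ℤ × b ≡ 0ℤ
  nonneg-+-zero (zero , refl) (zero , refl) _ = refl , refl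
  nonneg-+-zero (zero , refl) (suc _ , refl) ()
  nonneg-+-zero (suc _ , refl) (_ , refl) ()

  nonneg-sum-zero : ∀ {n} {f : Fin n → ℤ} → (∀ i → Nonneg (f i)) → sum f ≡ 0ℤ → ∀ i → f i ≡ 0ℤ
  nonneg-sum-zero {suc n} {f} h Σ≡0 = pointwise
    where
    head-and-tail : f zero ≡ 0ℤ × sum (f ∘ suc) ≡ 0ℤ
    head-and-tail = nonneg-+-zero (h zero) (nonneg-sum (h ∘ suc)) Σ≡0
    pointwise : ∀ i → f i ≡ 0ℤ
    pointwise zero    = proj₁ head-and-tail
    pointwise (suc i) = nonneg-sum-zero (h ∘ suc) (proj₂ head-and-tail) i

  IsSign : ℤ → Set
  IsSign z = z ≡ 1ℤ ⊎ z ≡ -1ℤ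

  isSign-* : ∀ {a b} → IsSign a → IsSign b → IsSign (a * b)
  isSign-* (inj₁ refl) (inj₁ refl) = inj₁ refl
  isSign-* (inj₁ refl) (inj₂ refl) = inj₂ refl
  isSign-* (inj₂ refl) (inj₁ refl) = inj₂ refl
  isSign-* (inj₂ refl) (inj₂ refl) = inj₁ refl

  isSign-neg : ∀ {a} → IsSign a → IsSign (- a)
  isSign-neg (inj₁ refl) = inj₂ refl
  isSign-neg (inj₂ refl) = inj₁ refl

  isSign-square : ∀ {a} → IsSign a → a * a ≡ 1ℤ
  isSign-square (inj₁ refl) = refl
  isSign-square (inj₂ refl) = refl

  square≡1⇒isSign : ∀ z → z * z ≡ 1ℤ → IsSign z
  square≡1⇒isSign (+ suc k) z²≡1 with ℕ.m*n≡1⇒m≡1 (suc k) (suc k) (+-injective z²≡1)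
  ... | refl = inj₁ refl
  square≡1⇒isSign -[1+ k ] z²≡1 with ℕ.m*n≡1⇒m≡1 (suc k) (suc k) (+-injective z²≡1)
  ... | refl = inj₂ refl

  nonzero-square : ∀ z → z ≢ 0ℤ → ∃ λ k → z * z ≡ + suc k
  nonzero-square (+ zero)  z≢0 = ⊥-elim (z≢0 refl)
  nonzero-square (+ suc k) _   = _ , refl
  nonzero-square -[1+ k ]  _   = _ , refl

  square≡0 : ∀ z → z * z ≡ 0ℤ → z ≡ 0ℤ
  square≡0 (+ zero) _ = refl

  sum-signs-parity : ∀ {n} (f : Fin n → ℤ) → (∀ i → IsSign (f i)) → ∃ λ c → sum f + + (2 ℕ.* c) ≡ + n
  sum-signs-parity {zero}  f h = 0 , refl
  sum-signs-parity {suc n} f h with sum-signs-parity (f ∘ suc) (h ∘ suc) | h zero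
  ... | c , eq | inj₁ f₀≡1 = c , (begin
      f zero + rest + + (2 ℕ.* c)   ≡⟨ cong (λ a → a + rest + + (2 ℕ.* c)) f₀≡1 ⟩
      1ℤ + rest + + (2 ℕ.* c)       ≡⟨ +-assoc 1ℤ rest (+ (2 ℕ.* c)) ⟩
      1ℤ + (rest + + (2 ℕ.* c))     ≡⟨ cong (_+_ 1ℤ) eq ⟩
      + suc n                       ∎)
    where
    open ≡-Reasoning
    rest : ℤ
    rest = sum (f ∘ suc)
  ... | c , eq | inj₂ f₀≡-1 = suc c , (begin
      f zero + rest + + (2 ℕ.* suc c)   ≡⟨ cong₂ (λ a b → a + rest + b) f₀≡-1 (pos-* 2 (suc c)) ⟩
      -1ℤ + rest + + 2 * (1ℤ + + c)     ≡⟨ shift rest (+ c) ⟩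
      1ℤ + (rest + + 2 * + c)           ≡⟨ cong (λ b → 1ℤ + (rest + b)) (pos-* 2 c) ⟨
      1ℤ + (rest + + (2 ℕ.* c))         ≡⟨ cong (_+_ 1ℤ) eq ⟩
      + suc n                           ∎)
    where
    open ≡-Reasoning
    rest : ℤ
    rest = sum (f ∘ suc)
    shift : ∀ x c → -1ℤ + x + + 2 * (1ℤ + c) ≡ 1ℤ + (x + + 2 * c)
    shift = solve-∀

  Multiple4 : ℤ → Set
  Multiple4 z = ∃ λ q → z ≡ + (4 ℕ.* q)

  multiple4-+ : ∀ {a b} → Multiple4 a → Multiple4 b → Multiple4 (a + b)
  multiple4-+ (p , refl) (q , refl) = p ℕ.+ q , trans (sym (pos-+ (4 ℕ.* p) (4 ℕ.* q))) (cong +_ (sym (ℕ.*-distribˡ-+ 4 p q)))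

  multiple4-sum : ∀ {n} {f : Fin n → ℤ} → (∀ i → Multiple4 (f i)) → Multiple4 (sum f)
  multiple4-sum {zero}  _ = 0 , refl
  multiple4-sum {suc n} h = multiple4-+ (h zero) (multiple4-sum (h ∘ suc))

  signs-mod4 : ∀ {a b c} → IsSign a → IsSign b → IsSign c → Multiple4 ((a + b) * (a + c))
  signs-mod4 (inj₁ refl) (inj₁ refl) (inj₁ refl) = 1 , refl
  signs-mod4 (inj₁ refl) (inj₁ refl) (inj₂ refl) = 0 , refl
  signs-mod4 (inj₁ refl) (inj₂ refl) _           = 0 , refl
  signs-mod4 (inj₂ refl) (inj₁ refl) _           = 0 , refl
  signs-mod4 (inj₂ refl) (inj₂ refl) (inj₁ refl) = 0 , refl
  signs-mod4 (inj₂ refl) (inj₂ refl) (inj₂ refl) = 1 , refl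

  module _ {n} {f : Fin n → Fin n → ℤ} where

    private
      weighted-nonneg : (∀ {i j} → i ≢ j → Nonneg (f i j)) → ∀ i j → Nonneg (δᶜ i j * f i j)
      weighted-nonneg h i j with i ≟ j
      ... | yes _ = 0 , refl
      ... | no i≢j = subst Nonneg (sym (*-identityˡ (f i j))) (h i≢j)

    offdiag-sum-nonneg : (∀ {i j} → i ≢ j → Nonneg (f i j)) → Nonneg (offdiag-sum f)
    offdiag-sum-nonneg h = nonneg-sum λ i → nonneg-sum λ j → weighted-nonneg h i j

    offdiag-sum-zero : (∀ {i j} → i ≢ j → Nonneg (f i j)) → offdiag-sum f ≡ 0ℤ → ∀ {i j} → i ≢ j → f i j ≡ 0ℤ
    offdiag-sum-zero h Σ≡0 {i} {j} i≢j = begin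
      f i j               ≡⟨ *-identityˡ (f i j) ⟨
      1ℤ * f i j          ≡⟨ cong (_* f i j) (δᶜ-≢ i≢j) ⟨
      δᶜ i j * f i j      ≡⟨ nonneg-sum-zero (weighted-nonneg h i) (nonneg-sum-zero (λ i → nonneg-sum (weighted-nonneg h i)) Σ≡0 i) j ⟩
      0ℤ                  ∎
      where open ≡-Reasoning

module Symmetrisation where

  open import Data.Integer using (ℤ; 0ℤ; 1ℤ; +_; _+_; _*_)
  open import Data.Integer.Properties using (*-identityˡ; *-identityʳ; *-assoc; *-distribʳ-+)
  open import Data.Integer.Tactic.RingSolver using (solve-∀)
  open import Data.Fin using (_<_)
  open import Data.Fin.Properties using (<-cmp; <-trans; <-asym; <⇒≢)
  import Data.Nat as ℕ
  open import Relation.Binary.Definitions using (tri<; tri≈; tri>)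
  open Sums

  lt : ∀ {n} → Fin n → Fin n → ℤ
  lt i j = 𝟙 (ltB (toℕ i) (toℕ j))

  lt-yes : ∀ {n} {i j : Fin n} → i < j → lt i j ≡ 1ℤ
  lt-yes {i = i} {j} i<j with toℕ i ℕ.<? toℕ j
  ... | yes _ = refl
  ... | no i≮j = ⊥-elim (i≮j i<j)

  lt-no : ∀ {n} {i j : Fin n} → ¬ i < j → lt i j ≡ 0ℤ
  lt-no {i = i} {j} i≮j with toℕ i ℕ.<? toℕ j
  ... | yes i<j = ⊥-elim (i≮j i<j)
  ... | no _ = refl

  lt-guard : ∀ {n} (i j : Fin n) {x y} → (i < j → x ≡ y) → lt i j * x ≡ lt i j * y
  lt-guard i j h with toℕ i ℕ.<? toℕ j
  ... | yes i<j = cong (1ℤ *_) (h i<j)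
  ... | no _ = refl

  lt-trans : ∀ {n} (i j k : Fin n) → lt i j * lt j k * lt i k ≡ lt i j * lt j k
  lt-trans i j k = begin
    lt i j * lt j k * lt i k    ≡⟨ *-assoc (lt i j) (lt j k) (lt i k) ⟩
    lt i j * (lt j k * lt i k)  ≡⟨ (lt-guard i j λ i<j → lt-guard j k λ j<k → lt-yes (<-trans i<j j<k)) ⟩
    lt i j * (lt j k * 1ℤ)      ≡⟨ cong (lt i j *_) (*-identityʳ (lt j k)) ⟩
    lt i j * lt j k             ∎
    where open ≡-Reasoning

  δᶜ-trichotomy : ∀ {n} (i j : Fin n) → δᶜ i j ≡ lt i j + lt j i
  δᶜ-trichotomy i j with <-cmp i j
  ... | tri< i<j _ j≮i rewrite δᶜ-≢ (<⇒≢ i<j) | lt-yes i<j | lt-no j≮i = refl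
  ... | tri≈ i≮i refl _ rewrite δᶜ-refl i | lt-no i≮i = refl
  ... | tri> i≮j _ j<i rewrite δᶜ-≢ (<⇒≢ j<i ∘ sym) | lt-no i≮j | lt-yes j<i = refl

  δᶜ-insert₂ : ∀ {n} {i j : Fin n} (k : Fin n) → i < j →
    δᶜ i k * δᶜ j k ≡ lt j k + lt i k * lt k j + lt k i
  δᶜ-insert₂ {i = i} {j} k i<j with <-cmp k i
  ... | tri< k<i _ _ rewrite δᶜ-≢ (<⇒≢ k<i ∘ sym) | δᶜ-≢ (<⇒≢ (<-trans k<i i<j) ∘ sym)
                           | lt-no (<-asym (<-trans k<i i<j)) | lt-no (<-asym k<i) | lt-yes k<i = refl
  ... | tri≈ k≮k refl _ rewrite δᶜ-refl k | lt-no (<-asym i<j) | lt-no k≮k = refl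
  ... | tri> _ _ i<k rewrite δᶜ-≢ (<⇒≢ i<k) | lt-yes i<k | lt-no (<-asym i<k) | δᶜ-trichotomy j k =
    rearrange (lt j k) (lt k j)
    where
    rearrange : ∀ a b → 1ℤ * (a + b) ≡ a + 1ℤ * b + 0ℤ
    rearrange = solve-∀

  δᶜ-insert₃ : ∀ {n} {i j k : Fin n} (l : Fin n) → i < j → j < k →
    δᶜ i l * δᶜ j l * δᶜ k l ≡ lt k l + lt j l * lt l k + lt i l * lt l j + lt l i
  δᶜ-insert₃ {i = i} {j} {k} l i<j j<k with <-cmp l j
  ... | tri< l<j _ _ rewrite δᶜ-≢ (<⇒≢ l<j ∘ sym) | δᶜ-≢ (<⇒≢ (<-trans l<j j<k) ∘ sym)
                           | lt-no (<-asym (<-trans l<j j<k)) | lt-no (<-asym l<j) | lt-yes l<j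
                           | δᶜ-trichotomy i l =
    rearrange (lt i l) (lt l i) (lt l k)
    where
    rearrange : ∀ a b c → (a + b) * 1ℤ * 1ℤ ≡ 0ℤ + 0ℤ * c + a * 1ℤ + b
    rearrange = solve-∀
  ... | tri≈ l≮l refl _ rewrite δᶜ-refl l | lt-no (<-asym j<k) | lt-no l≮l | lt-no (<-asym i<j) =
    rearrange (δᶜ i l) (δᶜ k l) (lt i l) (lt l k)
    where
    rearrange : ∀ a b c d → a * 0ℤ * b ≡ 0ℤ + 0ℤ * d + c * 0ℤ + 0ℤ
    rearrange = solve-∀
  ... | tri> _ _ j<l rewrite δᶜ-≢ (<⇒≢ (<-trans i<j j<l)) | δᶜ-≢ (<⇒≢ j<l)
                           | lt-yes (<-trans i<j j<l) | lt-yes j<l | lt-no (<-asym j<l)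
                           | lt-no (<-asym (<-trans i<j j<l)) | δᶜ-trichotomy k l =
    rearrange (lt k l) (lt l k)
    where
    rearrange : ∀ a b → 1ℤ * 1ℤ * (a + b) ≡ a + 1ℤ * b + 1ℤ * 0ℤ + 0ℤ
    rearrange = solve-∀

  increasing⇒distinct₄ : ∀ {n} (i j k l : Fin n) →
    lt i j * lt j k * lt k l * distinct₄ i j k l ≡ lt i j * lt j k * lt k l
  increasing⇒distinct₄ i j k l = begin
      lt i j * lt j k * lt k l * distinct₄ i j k l
    ≡⟨ nest (lt i j) (lt j k) (lt k l) (distinct₄ i j k l) ⟩
      lt i j * (lt j k * (lt k l * distinct₄ i j k l))
    ≡⟨ (lt-guard i j λ i<j → lt-guard j k λ j<k → lt-guard k l λ k<l →
         let i<k = <-trans i<j j<k in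
         distinct₄-≢ (<⇒≢ i<j) (<⇒≢ i<k) (<⇒≢ j<k) (<⇒≢ (<-trans i<k k<l)) (<⇒≢ (<-trans j<k k<l)) (<⇒≢ k<l)) ⟩
      lt i j * (lt j k * (lt k l * 1ℤ))
    ≡⟨ sym (nest (lt i j) (lt j k) (lt k l) 1ℤ) ⟩
      lt i j * lt j k * lt k l * 1ℤ
    ≡⟨ *-identityʳ _ ⟩
      lt i j * lt j k * lt k l ∎
    where
    open ≡-Reasoning
    nest : ∀ a b c d → a * b * c * d ≡ a * (b * (c * d))
    nest = solve-∀

  module _ {n} (F : Fin n → Fin n → Fin n → Fin n → ℤ)
    (F-swap₁₂ : ∀ i j k l → F j i k l ≡ F i j k l)
    (F-swap₂₃ : ∀ i j k l → F i k j l ≡ F i j k l)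
    (F-swap₃₄ : ∀ i j k l → F i j l k ≡ F i j k l)
    (F-diagonal : ∀ i k l → F i i k l ≡ 0ℤ) where

    private
      δᶜ-absorb : ∀ (i j : Fin n) {x} → (i ≡ j → x ≡ 0ℤ) → δᶜ i j * x ≡ x
      δᶜ-absorb i j {x} h with i ≟ j
      ... | yes i≡j = sym (h i≡j)
      ... | no _ = *-identityˡ x

      vanish₁₃ : ∀ i j l → F i j i l ≡ 0ℤ
      vanish₁₃ i j l = trans (F-swap₂₃ i i j l) (F-diagonal i j l)

      vanish₂₃ : ∀ i j l → F i j j l ≡ 0ℤ
      vanish₂₃ i j l = trans (F-swap₁₂ j i j l) (vanish₁₃ j i l)

      vanish₃₄ : ∀ i j k → F i j k k ≡ 0ℤ
      vanish₃₄ i j k = trans (F-swap₂₃ i k j k) (trans (F-swap₃₄ i k k j) (vanish₂₃ i k j))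

      absorb₁ : ∀ i j k l → δᶜ i j * F i j k l ≡ F i j k l
      absorb₁ i j k l = δᶜ-absorb i j λ where refl → F-diagonal i k l

      absorb₂ : ∀ i j k l → δᶜ i k * δᶜ j k * F i j k l ≡ F i j k l
      absorb₂ i j k l = begin
        δᶜ i k * δᶜ j k * F i j k l    ≡⟨ *-assoc (δᶜ i k) (δᶜ j k) (F i j k l) ⟩
        δᶜ i k * (δᶜ j k * F i j k l)  ≡⟨ cong (δᶜ i k *_) (δᶜ-absorb j k λ where refl → vanish₂₃ i j l) ⟩
        δᶜ i k * F i j k l             ≡⟨ δᶜ-absorb i k (λ where refl → vanish₁₃ i j l) ⟩
        F i j k l                      ∎
        where open ≡-Reasoning

      absorb₃ : ∀ i j k l → δᶜ i l * δᶜ j l * δᶜ k l * F i j k l ≡ F i j k l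
      absorb₃ i j k l = begin
        δᶜ i l * δᶜ j l * δᶜ k l * F i j k l      ≡⟨ nest (δᶜ i l) (δᶜ j l) (δᶜ k l) (F i j k l) ⟩
        δᶜ i l * (δᶜ j l * (δᶜ k l * F i j k l))  ≡⟨ cong (λ x → δᶜ i l * (δᶜ j l * x)) (δᶜ-absorb k l λ where refl → vanish₃₄ i j k) ⟩
        δᶜ i l * (δᶜ j l * F i j k l)             ≡⟨ cong (δᶜ i l *_) (δᶜ-absorb j l λ where refl → trans (F-swap₃₄ i j j k) (vanish₂₃ i j k)) ⟩
        δᶜ i l * F i j k l                        ≡⟨ δᶜ-absorb i l (λ where refl → trans (F-swap₃₄ i j i k) (vanish₁₃ i j k)) ⟩
        F i j k l                                 ∎
        where
        open ≡-Reasoning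
        nest : ∀ a b c x → a * b * c * x ≡ a * (b * (c * x))
        nest = solve-∀

    -- Each stage inserts one more index into the sorted chain of the previous ones; after
    -- renaming the indices, every possible position contributes the same sum.
    ordered₁₂ ordered₁₂₃ ordered₁₂₃₄ : Fin n → Fin n → Fin n → Fin n → ℤ
    ordered₁₂ i j k l = lt i j * F i j k l
    ordered₁₂₃ i j k l = lt i j * lt j k * F i j k l
    ordered₁₂₃₄ i j k l = lt i j * lt j k * lt k l * F i j k l

    private
      ordered₁₂-split : ∀ i j k l → F i j k l ≡ ordered₁₂ i j k l + lt j i * F i j k l
      ordered₁₂-split i j k l = begin
        F i j k l                               ≡⟨ absorb₁ i j k l ⟨
        δᶜ i j * F i j k l                      ≡⟨ cong (_* F i j k l) (δᶜ-trichotomy i j) ⟩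
        (lt i j + lt j i) * F i j k l           ≡⟨ *-distribʳ-+ (F i j k l) (lt i j) (lt j i) ⟩
        ordered₁₂ i j k l + lt j i * F i j k l  ∎
        where open ≡-Reasoning

      k-between k-first : Fin n → Fin n → Fin n → Fin n → ℤ
      k-between i j k l = lt i k * lt k j * lt i j * F i j k l
      k-first i j k l = lt k i * lt i j * F i j k l

      ordered₁₂₃-split : ∀ i j k l → ordered₁₂ i j k l ≡ ordered₁₂₃ i j k l + k-between i j k l + k-first i j k l
      ordered₁₂₃-split i j k l = begin
          lt i j * F i j k l
        ≡⟨ cong (lt i j *_) (absorb₂ i j k l) ⟨
          lt i j * (δᶜ i k * δᶜ j k * F i j k l)
        ≡⟨ *-assoc (lt i j) (δᶜ i k * δᶜ j k) (F i j k l) ⟨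
          lt i j * (δᶜ i k * δᶜ j k) * F i j k l
        ≡⟨ cong (_* F i j k l) (lt-guard i j (δᶜ-insert₂ k)) ⟩
          lt i j * (lt j k + lt i k * lt k j + lt k i) * F i j k l
        ≡⟨ expand (lt i j) (lt j k) (lt i k) (lt k j) (lt k i) (F i j k l) ⟩
          ordered₁₂₃ i j k l + k-between i j k l + k-first i j k l ∎
        where
        open ≡-Reasoning
        expand : ∀ a b c d e f → a * (b + c * d + e) * f ≡ a * b * f + c * d * a * f + e * a * f
        expand = solve-∀

      k-between-sorted : ∀ i j k l → k-between i k j l ≡ ordered₁₂₃ i j k l
      k-between-sorted i j k l = cong₂ _*_ (lt-trans i j k) (F-swap₂₃ i j k l)

      k-first-sorted : ∀ i j k l → k-first j k i l ≡ ordered₁₂₃ i j k l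
      k-first-sorted i j k l = cong (lt i j * lt j k *_) (trans (F-swap₂₃ j i k l) (F-swap₁₂ i j k l))

      l-between₂₃ l-between₁₂ l-first : Fin n → Fin n → Fin n → Fin n → ℤ
      l-between₂₃ i j k l = lt i j * (lt j l * lt l k * lt j k) * F i j k l
      l-between₁₂ i j k l = lt i l * lt l j * lt i j * lt j k * F i j k l
      l-first i j k l = lt l i * lt i j * lt j k * F i j k l

      ordered₁₂₃₄-split : ∀ i j k l →
        ordered₁₂₃ i j k l ≡ ordered₁₂₃₄ i j k l + l-between₂₃ i j k l + l-between₁₂ i j k l + l-first i j k l
      ordered₁₂₃₄-split i j k l = begin
          lt i j * lt j k * F i j k l
        ≡⟨ cong (lt i j * lt j k *_) (absorb₃ i j k l) ⟨
          lt i j * lt j k * (δᶜ i l * δᶜ j l * δᶜ k l * F i j k l)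
        ≡⟨ nest (lt i j) (lt j k) (δᶜ i l * δᶜ j l * δᶜ k l) (F i j k l) ⟩
          lt i j * (lt j k * (δᶜ i l * δᶜ j l * δᶜ k l)) * F i j k l
        ≡⟨ cong (_* F i j k l) (lt-guard i j λ i<j → lt-guard j k λ j<k → δᶜ-insert₃ l i<j j<k) ⟩
          lt i j * (lt j k * (lt k l + lt j l * lt l k + lt i l * lt l j + lt l i)) * F i j k l
        ≡⟨ expand (lt i j) (lt j k) (lt k l) (lt j l) (lt l k) (lt i l) (lt l j) (lt l i) (F i j k l) ⟩
          ordered₁₂₃₄ i j k l + l-between₂₃ i j k l + l-between₁₂ i j k l + l-first i j k l ∎
        where
        open ≡-Reasoning
        nest : ∀ a b c f → a * b * (c * f) ≡ a * (b * c) * f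
        nest = solve-∀
        expand : ∀ a b c d e g h m f →
          a * (b * (c + d * e + g * h + m)) * f ≡ a * b * c * f + a * (d * e * b) * f + g * h * a * b * f + m * a * b * f
        expand = solve-∀

      l-between₂₃-sorted : ∀ i j k l → l-between₂₃ i j l k ≡ ordered₁₂₃₄ i j k l
      l-between₂₃-sorted i j k l =
        trans (cong₂ _*_ (cong (lt i j *_) (lt-trans j k l)) (F-swap₃₄ i j k l))
              (cong (_* F i j k l) (sym (*-assoc (lt i j) (lt j k) (lt k l))))

      l-between₁₂-sorted : ∀ i j k l → l-between₁₂ i k l j ≡ ordered₁₂₃₄ i j k l
      l-between₁₂-sorted i j k l =
        cong₂ _*_ (cong (_* lt k l) (lt-trans i j k)) (trans (F-swap₃₄ i k j l) (F-swap₂₃ i j k l))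

      l-first-sorted : ∀ i j k l → l-first j k l i ≡ ordered₁₂₃₄ i j k l
      l-first-sorted i j k l =
        cong (lt i j * lt j k * lt k l *_) (trans (F-swap₃₄ j k i l) (trans (F-swap₂₃ j i k l) (F-swap₁₂ i j k l)))

    sum⁴-order₁₂ : sum⁴ F ≡ + 2 * sum⁴ ordered₁₂
    sum⁴-order₁₂ = begin
        sum⁴ F
      ≡⟨ sum⁴-cong ordered₁₂-split ⟩
        sum⁴ (λ i j k l → ordered₁₂ i j k l + lt j i * F i j k l)
      ≡⟨ sum⁴-+ ordered₁₂ (λ i j k l → lt j i * F i j k l) ⟩
        sum⁴ ordered₁₂ + sum⁴ (λ i j k l → lt j i * F i j k l)
      ≡⟨ cong (_+_ (sum⁴ ordered₁₂)) (trans (sum⁴-swap₁₂ (λ i j k l → lt j i * F i j k l))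
           (sum⁴-cong λ i j k l → cong (lt i j *_) (F-swap₁₂ i j k l))) ⟩
        sum⁴ ordered₁₂ + sum⁴ ordered₁₂
      ≡⟨ double (sum⁴ ordered₁₂) ⟩
        + 2 * sum⁴ ordered₁₂ ∎
      where
      open ≡-Reasoning
      double : ∀ x → x + x ≡ + 2 * x
      double = solve-∀

    sum⁴-order₁₂₃ : sum⁴ ordered₁₂ ≡ + 3 * sum⁴ ordered₁₂₃
    sum⁴-order₁₂₃ = begin
        sum⁴ ordered₁₂
      ≡⟨ sum⁴-cong ordered₁₂₃-split ⟩
        sum⁴ (λ i j k l → ordered₁₂₃ i j k l + k-between i j k l + k-first i j k l)
      ≡⟨ trans (sum⁴-+ (λ i j k l → ordered₁₂₃ i j k l + k-between i j k l) k-first)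
               (cong (_+ sum⁴ k-first) (sum⁴-+ ordered₁₂₃ k-between)) ⟩
        sum⁴ ordered₁₂₃ + sum⁴ k-between + sum⁴ k-first
      ≡⟨ cong₂ (λ x y → sum⁴ ordered₁₂₃ + x + y)
           (trans (sum⁴-swap₂₃ k-between) (sum⁴-cong k-between-sorted))
           (trans (sum⁴-rotate₁₂₃ k-first) (sum⁴-cong k-first-sorted)) ⟩
        sum⁴ ordered₁₂₃ + sum⁴ ordered₁₂₃ + sum⁴ ordered₁₂₃
      ≡⟨ triple (sum⁴ ordered₁₂₃) ⟩
        + 3 * sum⁴ ordered₁₂₃ ∎
      where
      open ≡-Reasoning
      triple : ∀ x → x + x + x ≡ + 3 * x
      triple = solve-∀

    sum⁴-order₁₂₃₄ : sum⁴ ordered₁₂₃ ≡ + 4 * sum⁴ ordered₁₂₃₄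
    sum⁴-order₁₂₃₄ = begin
        sum⁴ ordered₁₂₃
      ≡⟨ sum⁴-cong ordered₁₂₃₄-split ⟩
        sum⁴ (λ i j k l → ordered₁₂₃₄ i j k l + l-between₂₃ i j k l + l-between₁₂ i j k l + l-first i j k l)
      ≡⟨ trans (sum⁴-+ (λ i j k l → ordered₁₂₃₄ i j k l + l-between₂₃ i j k l + l-between₁₂ i j k l) l-first)
           (cong (_+ sum⁴ l-first) (trans (sum⁴-+ (λ i j k l → ordered₁₂₃₄ i j k l + l-between₂₃ i j k l) l-between₁₂)
             (cong (_+ sum⁴ l-between₁₂) (sum⁴-+ ordered₁₂₃₄ l-between₂₃)))) ⟩
        sum⁴ ordered₁₂₃₄ + sum⁴ l-between₂₃ + sum⁴ l-between₁₂ + sum⁴ l-first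
      ≡⟨ cong₃ (λ x y z → sum⁴ ordered₁₂₃₄ + x + y + z)
           (trans (sum⁴-swap₃₄ l-between₂₃) (sum⁴-cong l-between₂₃-sorted))
           (trans (sum⁴-rotate₂₃₄ l-between₁₂) (sum⁴-cong l-between₁₂-sorted))
           (trans (sum⁴-rotate₁₂₃₄ l-first) (sum⁴-cong l-first-sorted)) ⟩
        sum⁴ ordered₁₂₃₄ + sum⁴ ordered₁₂₃₄ + sum⁴ ordered₁₂₃₄ + sum⁴ ordered₁₂₃₄
      ≡⟨ quadruple (sum⁴ ordered₁₂₃₄) ⟩
        + 4 * sum⁴ ordered₁₂₃₄ ∎
      where
      open ≡-Reasoning
      quadruple : ∀ x → x + x + x + x ≡ + 4 * x
      quadruple = solve-∀

    sum⁴-symmetric : sum⁴ F ≡ + 24 * sum⁴ (λ i j k l → lt i j * lt j k * lt k l * F i j k l)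
    sum⁴-symmetric = begin
      sum⁴ F                                   ≡⟨ sum⁴-order₁₂ ⟩
      + 2 * sum⁴ ordered₁₂                     ≡⟨ cong (+ 2 *_) sum⁴-order₁₂₃ ⟩
      + 2 * (+ 3 * sum⁴ ordered₁₂₃)            ≡⟨ cong (λ x → + 2 * (+ 3 * x)) sum⁴-order₁₂₃₄ ⟩
      + 2 * (+ 3 * (+ 4 * sum⁴ ordered₁₂₃₄))   ≡⟨ collect (sum⁴ ordered₁₂₃₄) ⟩
      + 24 * sum⁴ ordered₁₂₃₄                  ∎
      where
      open ≡-Reasoning
      collect : ∀ x → + 2 * (+ 3 * (+ 4 * x)) ≡ + 24 * x
      collect = solve-∀

module SkewSignMatrices where

  open import Data.Integer using (ℤ; +_; 0ℤ; 1ℤ; _+_; _*_; -_; _-_)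
  open import Data.Integer.Properties using (*-comm; *-identityˡ; *-identityʳ; +-identityʳ)
  open import Data.Integer.Tactic.RingSolver using (solve-∀)
  import Data.Nat as ℕ
  open Sums
  open Signs

  record IsSkewSignMatrix (m : ℕ) (A : Fin m → Fin m → ℤ) : Set where
    field
      diag0   : ∀ i → A i i ≡ 0ℤ
      offdiag : ∀ i j → i ≢ j → IsSign (A i j)
      skew    : ∀ i j → A j i ≡ - A i j

  gram : ∀ {m} → (Fin m → Fin m → ℤ) → Fin m → Fin m → ℤ
  gram A i j = sum λ k → A i k * A j k

  module SkewSign {m : ℕ} {A : Fin m → Fin m → ℤ} (isSkewSign : IsSkewSignMatrix m A) where

    open IsSkewSignMatrix isSkewSign public

    gram-sym : ∀ i j → gram A i j ≡ gram A j i
    gram-sym i j = sum-cong-≗ λ k → *-comm (A i k) (A j k)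

    gram-columns : ∀ i j → sum (λ k → A k i * A k j) ≡ gram A i j
    gram-columns i j = sum-cong-≗ λ k → trans (cong₂ _*_ (skew i k) (skew j k)) (neg-*-neg (A i k) (A j k))
      where
      neg-*-neg : ∀ a b → - a * - b ≡ a * b
      neg-*-neg = solve-∀

    entry-absorb : ∀ i j → A i j ≡ δᶜ i j * A i j
    entry-absorb i j with i ≟ j
    ... | yes refl = diag0 i
    ... | no _ = sym (*-identityˡ (A i j))

    entry-square : ∀ i j → A i j * A i j ≡ δᶜ i j
    entry-square i j with i ≟ j
    ... | yes refl rewrite diag0 i = refl
    ... | no i≢j = isSign-square (offdiag i j i≢j)

    gram-diag : ∀ i → gram A i i ≡ + m - 1ℤ
    gram-diag i = trans (sum-cong-≗ (entry-square i)) (sum-δᶜ i)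

    -- Parity and residues mod 4 are counted on A + I, a ±1 matrix with the same
    -- off-diagonal Gram entries.
    private
      shifted : Fin m → Fin m → ℤ
      shifted i k = A i k + δ i k

      shifted-sign : ∀ i k → IsSign (shifted i k)
      shifted-sign i k with i ≟ k
      ... | yes refl rewrite diag0 i = inj₁ refl
      ... | no i≢k = subst IsSign (sym (+-identityʳ (A i k))) (offdiag i k i≢k)

      shifted-gram : ∀ {i j} → i ≢ j → sum (λ k → shifted i k * shifted j k) ≡ gram A i j
      shifted-gram {i} {j} i≢j = begin
          sum (λ k → shifted i k * shifted j k)
        ≡⟨ sum-cong-≗ (λ k → expand (A i k) (A j k) (δ i k) (δ j k)) ⟩
          sum (λ k → A i k * A j k + (δ j k * A i k + (δ i k * A j k + δ i k * δ j k)))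
        ≡⟨ trans (∑-distrib-+ (λ k → A i k * A j k) _) (cong (_+_ (gram A i j))
             (trans (∑-distrib-+ (λ k → δ j k * A i k) _) (cong (_+_ (sum λ k → δ j k * A i k))
               (∑-distrib-+ (λ k → δ i k * A j k) (λ k → δ i k * δ j k))))) ⟩
          gram A i j + (sum (λ k → δ j k * A i k) + (sum (λ k → δ i k * A j k) + sum (λ k → δ i k * δ j k)))
        ≡⟨ cong (_+_ (gram A i j)) (cong₂ _+_ (sum-δ j (A i)) (cong₂ _+_ (sum-δ i (A j)) (sum-δ i (δ j)))) ⟩
          gram A i j + (A i j + (A j i + δ j i))
        ≡⟨ cong (λ x → gram A i j + (A i j + (x + δ j i))) (skew i j) ⟩
          gram A i j + (A i j + (- A i j + δ j i))
        ≡⟨ cong (λ x → gram A i j + (A i j + (- A i j + x))) (δ-≢ (i≢j ∘ sym)) ⟩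
          gram A i j + (A i j + (- A i j + 0ℤ))
        ≡⟨ cancel (gram A i j) (A i j) ⟩
          gram A i j ∎
        where
        open ≡-Reasoning
        expand : ∀ a b d e → (a + d) * (b + e) ≡ a * b + (e * a + (d * b + d * e))
        expand = solve-∀
        cancel : ∀ g a → g + (a + (- a + 0ℤ)) ≡ g
        cancel = solve-∀

    gram-parity : ∀ {i j} → i ≢ j → ∃ λ c → gram A i j + + (2 ℕ.* c) ≡ + m
    gram-parity {i} {j} i≢j with sum-signs-parity (λ k → shifted i k * shifted j k)
                                   (λ k → isSign-* (shifted-sign i k) (shifted-sign j k))
    ... | c , eq = c , trans (cong (_+ + (2 ℕ.* c)) (sym (shifted-gram i≢j))) eq

    gram-triangle : ∀ {i j k} → i ≢ j → i ≢ k → j ≢ k → Multiple4 (+ m + gram A i j + gram A i k + gram A j k)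
    gram-triangle {i} {j} {k} i≢j i≢k j≢k =
      subst Multiple4 expansion
        (multiple4-sum λ l → signs-mod4 (shifted-sign i l) (shifted-sign j l) (shifted-sign k l))
      where
      open ≡-Reasoning
      expand : ∀ a b c → (a + b) * (a + c) ≡ a * a + a * c + b * a + b * c
      expand = solve-∀
      swap-middle : ∀ a b c d → a + b + c + d ≡ a + c + b + d
      swap-middle = solve-∀
      row-norm : sum (λ l → shifted i l * shifted i l) ≡ + m
      row-norm = trans (sum-cong-≗ λ l → isSign-square (shifted-sign i l))
                       (trans (sum-const {m} 1ℤ) (*-identityʳ (+ m)))
      expansion : sum (λ l → (shifted i l + shifted j l) * (shifted i l + shifted k l)) ≡ + m + gram A i j + gram A i k + gram A j k
      expansion = begin
          sum (λ l → (shifted i l + shifted j l) * (shifted i l + shifted k l))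
        ≡⟨ sum-cong-≗ (λ l → expand (shifted i l) (shifted j l) (shifted k l)) ⟩
          sum (λ l → shifted i l * shifted i l + shifted i l * shifted k l + shifted j l * shifted i l + shifted j l * shifted k l)
        ≡⟨ trans (∑-distrib-+ (λ l → shifted i l * shifted i l + shifted i l * shifted k l + shifted j l * shifted i l) _)
             (cong (_+ sum (λ l → shifted j l * shifted k l))
               (trans (∑-distrib-+ (λ l → shifted i l * shifted i l + shifted i l * shifted k l) _)
                 (cong (_+ sum (λ l → shifted j l * shifted i l))
                   (∑-distrib-+ (λ l → shifted i l * shifted i l) (λ l → shifted i l * shifted k l))))) ⟩
          sum (λ l → shifted i l * shifted i l) + sum (λ l → shifted i l * shifted k l)
            + sum (λ l → shifted j l * shifted i l) + sum (λ l → shifted j l * shifted k l)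
        ≡⟨ cong₂ _+_ (cong₂ _+_ (cong₂ _+_ row-norm (shifted-gram i≢k))
             (trans (shifted-gram (i≢j ∘ sym)) (gram-sym j i))) (shifted-gram j≢k) ⟩
          + m + gram A i k + gram A i j + gram A j k
        ≡⟨ swap-middle (+ m) (gram A i k) (gram A i j) (gram A j k) ⟩
          + m + gram A i j + gram A i k + gram A j k ∎

    cross : Fin m → Fin m → Fin m → Fin m → ℤ
    cross i j k l = A i k * A j k * (A i l * A j l)

    gram-square : ∀ i j → gram A i j * gram A i j ≡ sum λ k → sum λ l → cross i j k l
    gram-square i j =
      trans (sym (sum-*ʳ (gram A i j) (λ k → A i k * A j k)))
            (sum-cong-≗ λ k → sym (sum-*ˡ (A i k * A j k) (λ l → A i l * A j l)))

    cross-diagonal : ∀ i j k → δᶜ i j * cross i j k k ≡ distinct₃ i j k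
    cross-diagonal i j k = begin
      δᶜ i j * (A i k * A j k * (A i k * A j k))    ≡⟨ regroup (δᶜ i j) (A i k) (A j k) ⟩
      δᶜ i j * (A i k * A i k) * (A j k * A j k)    ≡⟨ cong₂ (λ x y → δᶜ i j * x * y) (entry-square i k) (entry-square j k) ⟩
      distinct₃ i j k                              ∎
      where
      open ≡-Reasoning
      regroup : ∀ d a b → d * (a * b * (a * b)) ≡ d * (a * a) * (b * b)
      regroup = solve-∀

    cross-distinct : ∀ i j k l → δᶜ i j * δᶜ k l * cross i j k l ≡ distinct₄ i j k l * cross i j k l
    cross-distinct i j k l = begin
        δᶜ i j * δᶜ k l * (A i k * A j k * (A i l * A j l))
      ≡⟨ cong₂ (λ x y → δᶜ i j * δᶜ k l * (x * y)) (cong₂ _*_ (entry-absorb i k) (entry-absorb j k))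
                                                    (cong₂ _*_ (entry-absorb i l) (entry-absorb j l)) ⟩
        δᶜ i j * δᶜ k l * (δᶜ i k * A i k * (δᶜ j k * A j k) * (δᶜ i l * A i l * (δᶜ j l * A j l)))
      ≡⟨ regroup (δᶜ i j) (δᶜ k l) (δᶜ i k) (δᶜ j k) (δᶜ i l) (δᶜ j l) (A i k) (A j k) (A i l) (A j l) ⟩
        distinct₄ i j k l * (A i k * A j k * (A i l * A j l)) ∎
      where
      open ≡-Reasoning
      regroup : ∀ a b c d e f x y z w →
        a * b * (c * x * (d * y) * (e * z * (f * w))) ≡ a * c * d * (e * f * b) * (x * y * (z * w))
      regroup = solve-∀

    offdiag-squares : ℤ
    offdiag-squares = offdiag-sum λ i j → gram A i j * gram A i j

    offdiag-squares-expansion :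
      offdiag-squares ≡ + m * ((+ m - 1ℤ) * (+ m - + 2)) + sum⁴ (λ i j k l → distinct₄ i j k l * cross i j k l)
    offdiag-squares-expansion = begin
        offdiag-squares
      ≡⟨ (sum-cong-≗ λ i → sum-cong-≗ λ j → trans (cong (δᶜ i j *_) (gram-square i j))
           (trans (sym (sum-*ˡ (δᶜ i j) (λ k → sum (cross i j k))))
                  (sum-cong-≗ λ k → sym (sum-*ˡ (δᶜ i j) (cross i j k))))) ⟩
        sum⁴ (λ i j k l → δᶜ i j * cross i j k l)
      ≡⟨ sum⁴-cong split ⟩
        sum⁴ (λ i j k l → δ k l * (δᶜ i j * cross i j k l) + distinct₄ i j k l * cross i j k l)
      ≡⟨ sum⁴-+ (λ i j k l → δ k l * (δᶜ i j * cross i j k l)) (λ i j k l → distinct₄ i j k l * cross i j k l) ⟩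
        sum⁴ (λ i j k l → δ k l * (δᶜ i j * cross i j k l)) + sum⁴ (λ i j k l → distinct₄ i j k l * cross i j k l)
      ≡⟨ cong (_+ sum⁴ (λ i j k l → distinct₄ i j k l * cross i j k l)) diagonal-part ⟩
        + m * ((+ m - 1ℤ) * (+ m - + 2)) + sum⁴ (λ i j k l → distinct₄ i j k l * cross i j k l) ∎
      where
      open ≡-Reasoning
      split : ∀ i j k l → δᶜ i j * cross i j k l ≡ δ k l * (δᶜ i j * cross i j k l) + distinct₄ i j k l * cross i j k l
      split i j k l = trans (decompose (δᶜ i j) (δ k l) (cross i j k l)) (cong (_+_ (δ k l * (δᶜ i j * cross i j k l))) (cross-distinct i j k l))
        where
        decompose : ∀ a d x → a * x ≡ d * (a * x) + a * (1ℤ - d) * x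
        decompose = solve-∀
      diagonal-part : sum⁴ (λ i j k l → δ k l * (δᶜ i j * cross i j k l)) ≡ + m * ((+ m - 1ℤ) * (+ m - + 2))
      diagonal-part = begin
          sum⁴ (λ i j k l → δ k l * (δᶜ i j * cross i j k l))
        ≡⟨ (sum-cong-≗ λ i → sum-cong-≗ λ j → sum-cong-≗ λ k → trans (sum-δ k (λ l → δᶜ i j * cross i j k l)) (cross-diagonal i j k)) ⟩
          (sum λ (i : Fin m) → sum λ j → sum (distinct₃ i j))
        ≡⟨ (sum-cong-≗ λ (i : Fin m) → trans (sum-cong-≗ (sum-distinct₃ i)) (trans (sum-*ʳ (+ m - + 2) (δᶜ i)) (cong (_* (+ m - + 2)) (sum-δᶜ i)))) ⟩
          sum {m} (λ _ → (+ m - 1ℤ) * (+ m - + 2))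
        ≡⟨ sum-const {m} _ ⟩
          + m * ((+ m - 1ℤ) * (+ m - + 2)) ∎

    cross-pairings :
      + 3 * sum⁴ (λ i j k l → distinct₄ i j k l * cross i j k l)
        ≡ sum⁴ (λ i j k l → distinct₄ i j k l * (cross i j k l + cross i k j l + cross i l j k))
    cross-pairings = begin
        + 3 * X
      ≡⟨ triple X ⟩
        X + X + X
      ≡⟨ cong₂ (λ x y → X + x + y) second-pairing third-pairing ⟩
        X + sum⁴ (λ i j k l → distinct₄ i j k l * cross i k j l) + sum⁴ (λ i j k l → distinct₄ i j k l * cross i l j k)
      ≡⟨ sym (trans (sum⁴-+ (λ i j k l → distinct₄ i j k l * cross i j k l + distinct₄ i j k l * cross i k j l)
                            (λ i j k l → distinct₄ i j k l * cross i l j k))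
                    (cong (_+ sum⁴ (λ i j k l → distinct₄ i j k l * cross i l j k))
                          (sum⁴-+ (λ i j k l → distinct₄ i j k l * cross i j k l) (λ i j k l → distinct₄ i j k l * cross i k j l)))) ⟩
        sum⁴ (λ i j k l → distinct₄ i j k l * cross i j k l + distinct₄ i j k l * cross i k j l + distinct₄ i j k l * cross i l j k)
      ≡⟨ sum⁴-cong (λ i j k l → factor (distinct₄ i j k l) (cross i j k l) (cross i k j l) (cross i l j k)) ⟩
        sum⁴ (λ i j k l → distinct₄ i j k l * (cross i j k l + cross i k j l + cross i l j k)) ∎
      where
      open ≡-Reasoning
      X : ℤ
      X = sum⁴ (λ i j k l → distinct₄ i j k l * cross i j k l)
      triple : ∀ x → + 3 * x ≡ x + x + x
      triple = solve-∀
      factor : ∀ d a b c → d * a + d * b + d * c ≡ d * (a + b + c)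
      factor = solve-∀
      second-pairing : X ≡ sum⁴ (λ i j k l → distinct₄ i j k l * cross i k j l)
      second-pairing = trans (sum⁴-swap₂₃ (λ i j k l → distinct₄ i j k l * cross i j k l))
                             (sum⁴-cong λ i j k l → cong (_* cross i k j l) (distinct₄-swap₂₃ i j k l))
      third-pairing : X ≡ sum⁴ (λ i j k l → distinct₄ i j k l * cross i l j k)
      third-pairing = sym (trans (sum⁴-rotate₂₃₄ (λ i j k l → distinct₄ i j k l * cross i l j k))
                                 (sum⁴-cong λ i j k l → cong (_* cross i j k l) (trans (distinct₄-swap₃₄ i k j l) (distinct₄-swap₂₃ i j k l))))

module Tournaments where

  open import Data.Integer using (ℤ; +_; 0ℤ; 1ℤ; -1ℤ; _+_; _*_; -_; _-_)
  import Data.Integer as ℤ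
  open import Data.Integer.Properties using (*-assoc)
  open import Data.Integer.Tactic.RingSolver using (solve-∀)
  open import Data.Bool.Properties using (T-≡; ∧-comm; ∧-assoc; ∨-comm)
  open import Function.Bundles using (Equivalence)
  import Data.Nat as ℕ
  import Data.Nat.Tactic.RingSolver as ℕ
  open import Relation.Nullary.Decidable using (Dec; from-yes)
  open Sums
  open Signs
  open Symmetrisation
  open SkewSignMatrices

  sg : Bool → ℤ
  sg true  = 1ℤ
  sg false = -1ℤ

  cyclicᵇ : Bool → Bool → Bool → Bool
  cyclicᵇ ab bc ac = (ab ∧ bc ∧ not ac) ∨ (not ab ∧ not bc ∧ ac)

  isOne : ℕ → Bool
  isOne 1 = true
  isOne _ = false

  -- The arguments orient the arcs ij, ik, il, jk, jl, kl of a tournament on {i, j, k, l}: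
  -- true means the arc points from its first letter to its second.
  QuartetIdentity : Bool → Bool → Bool → Bool → Bool → Bool → Set
  QuartetIdentity ij ik il jk jl kl =
    sg ik * sg jk * (sg il * sg jl) + sg ij * - sg jk * (sg il * sg kl) + sg ij * - sg jl * (sg ik * - sg kl)
      ≡ 1ℤ - + 4 * 𝟙 (isOne (b2n (cyclicᵇ ij jk ik) ℕ.+ b2n (cyclicᵇ ij jl il) ℕ.+ b2n (cyclicᵇ ik kl il) ℕ.+ b2n (cyclicᵇ jk kl jl)))

  quartet-identity : ∀ ij ik il jk jl kl → QuartetIdentity ij ik il jk jl kl
  quartet-identity = from-yes (∀? λ a → ∀? λ b → ∀? λ c → ∀? λ d → ∀? λ e → ∀? λ f → quartetIdentity? a b c d e f)
    where
    ∀? : {P : Bool → Set} → (∀ b → Dec (P b)) → Dec (∀ b → P b)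
    ∀? P? with P? false | P? true
    ... | yes p | yes q = yes λ where false → p ; true → q
    ... | no ¬p | _     = no λ h → ¬p (h false)
    ... | yes _ | no ¬q = no λ h → ¬q (h true)
    quartetIdentity? : ∀ a b c d e f → Dec (QuartetIdentity a b c d e f)
    quartetIdentity? a b c d e f = _ ℤ.≟ _

  module _ {n : ℕ} (t : Tournament n) where

    adj-flip : ∀ {i j} → i ≢ j → adj t j i ≡ not (adj t i j)
    adj-flip {i} {j} i≢j with adj t i j in eq
    ... | true  = antisym t i j (subst T (sym eq) _)
    ... | false = Equivalence.to T-≡ (subst (λ b → T (b ∨ adj t j i)) eq (tot t i j i≢j))

    seidel-arc : ∀ {i j} → i ≢ j → seidel t i j ≡ sg (adj t i j)
    seidel-arc {i} {j} i≢j = trans (cong (λ b → 𝟙 (adj t i j) - 𝟙 b) (adj-flip i≢j)) (arc (adj t i j))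
      where
      arc : ∀ b → 𝟙 b - 𝟙 (not b) ≡ sg b
      arc true  = refl
      arc false = refl

    seidel-isSkewSign : IsSkewSignMatrix n (seidel t)
    seidel-isSkewSign = record
      { diag0   = λ i → cong (λ b → 𝟙 b - 𝟙 b) (irrefl t i)
      ; offdiag = λ i j i≢j → subst IsSign (sym (seidel-arc i≢j)) (sg-isSign (adj t i j))
      ; skew    = λ i j → swap (𝟙 (adj t i j)) (𝟙 (adj t j i))
      }
      where
      sg-isSign : ∀ b → IsSign (sg b)
      sg-isSign true  = inj₁ refl
      sg-isSign false = inj₂ refl
      swap : ∀ a b → b - a ≡ - (a - b)
      swap = solve-∀

    cyclic-arcs : ∀ {a b c} → a ≢ b → a ≢ c → b ≢ c → cyclic t a b c ≡ cyclicᵇ (adj t a b) (adj t b c) (adj t a c)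
    cyclic-arcs a≢b a≢c b≢c rewrite adj-flip a≢b | adj-flip a≢c | adj-flip b≢c = refl

    isDiamond-isOne : ∀ i j k l → isDiamond t i j k l ≡ isOne (cyclesIn4 t i j k l)
    isDiamond-isOne i j k l with cyclesIn4 t i j k l
    ... | 0 = refl
    ... | 1 = refl
    ... | suc (suc _) = refl

    open SkewSign seidel-isSkewSign

    cross-quartet : ∀ {i j k l} → i ≢ j → i ≢ k → j ≢ k → i ≢ l → j ≢ l → k ≢ l →
      cross i j k l + cross i k j l + cross i l j k ≡ 1ℤ - + 4 * 𝟙 (isDiamond t i j k l)
    cross-quartet {i} {j} {k} {l} i≢j i≢k j≢k i≢l j≢l k≢l
      rewrite isDiamond-isOne i j k l
            | cyclic-arcs i≢j i≢k j≢k | cyclic-arcs i≢j i≢l j≢l | cyclic-arcs i≢k i≢l k≢l | cyclic-arcs j≢k j≢l k≢l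
            | skew j k | skew j l | skew k l
            | seidel-arc i≢j | seidel-arc i≢k | seidel-arc i≢l | seidel-arc j≢k | seidel-arc j≢l | seidel-arc k≢l
      = quartet-identity (adj t i j) (adj t i k) (adj t i l) (adj t j k) (adj t j l) (adj t k l)

    cyclic-swap₁₂ : ∀ i j k → cyclic t j i k ≡ cyclic t i j k
    cyclic-swap₁₂ i j k =
      trans (∨-comm (adj t j i ∧ adj t i k ∧ adj t k j) (adj t i j ∧ adj t k i ∧ adj t j k))
            (cong₂ _∨_ (cong (adj t i j ∧_) (∧-comm (adj t k i) (adj t j k)))
                       (cong (adj t j i ∧_) (∧-comm (adj t i k) (adj t k j))))

    cyclic-swap₂₃ : ∀ i j k → cyclic t i k j ≡ cyclic t i j k
    cyclic-swap₂₃ i j k =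
      trans (∨-comm (adj t i k ∧ adj t k j ∧ adj t j i) (adj t k i ∧ adj t j k ∧ adj t i j))
            (cong₂ _∨_ (∧-reverse (adj t k i) (adj t j k) (adj t i j)) (∧-reverse (adj t i k) (adj t k j) (adj t j i)))
      where
      ∧-reverse : ∀ a b c → a ∧ b ∧ c ≡ c ∧ b ∧ a
      ∧-reverse a b c = trans (∧-comm a (b ∧ c)) (trans (cong (_∧ a) (∧-comm b c)) (∧-assoc c b a))

    cyclesIn4-swap₁₂ : ∀ i j k l → cyclesIn4 t j i k l ≡ cyclesIn4 t i j k l
    cyclesIn4-swap₁₂ i j k l rewrite cyclic-swap₁₂ i j k | cyclic-swap₁₂ i j l =
      ℕ-solve (b2n (cyclic t i j k)) (b2n (cyclic t i j l)) (b2n (cyclic t j k l)) (b2n (cyclic t i k l))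
      where
      ℕ-solve : ∀ a b c d → a ℕ.+ b ℕ.+ c ℕ.+ d ≡ a ℕ.+ b ℕ.+ d ℕ.+ c
      ℕ-solve = ℕ.solve-∀

    cyclesIn4-swap₂₃ : ∀ i j k l → cyclesIn4 t i k j l ≡ cyclesIn4 t i j k l
    cyclesIn4-swap₂₃ i j k l rewrite cyclic-swap₂₃ i j k | cyclic-swap₁₂ j k l =
      ℕ-solve (b2n (cyclic t i j k)) (b2n (cyclic t i k l)) (b2n (cyclic t i j l)) (b2n (cyclic t j k l))
      where
      ℕ-solve : ∀ a b c d → a ℕ.+ b ℕ.+ c ℕ.+ d ≡ a ℕ.+ c ℕ.+ b ℕ.+ d
      ℕ-solve = ℕ.solve-∀

    cyclesIn4-swap₃₄ : ∀ i j k l → cyclesIn4 t i j l k ≡ cyclesIn4 t i j k l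
    cyclesIn4-swap₃₄ i j k l rewrite cyclic-swap₂₃ i k l | cyclic-swap₂₃ j k l =
      ℕ-solve (b2n (cyclic t i j l)) (b2n (cyclic t i j k)) (b2n (cyclic t i k l)) (b2n (cyclic t j k l))
      where
      ℕ-solve : ∀ a b c d → a ℕ.+ b ℕ.+ c ℕ.+ d ≡ b ℕ.+ a ℕ.+ c ℕ.+ d
      ℕ-solve = ℕ.solve-∀

    diamond : Fin n → Fin n → Fin n → Fin n → ℤ
    diamond i j k l = 𝟙 (isDiamond t i j k l)

    diamond-swap₁₂ : ∀ i j k l → diamond j i k l ≡ diamond i j k l
    diamond-swap₁₂ i j k l rewrite isDiamond-isOne j i k l | isDiamond-isOne i j k l | cyclesIn4-swap₁₂ i j k l = refl

    diamond-swap₂₃ : ∀ i j k l → diamond i k j l ≡ diamond i j k l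
    diamond-swap₂₃ i j k l rewrite isDiamond-isOne i k j l | isDiamond-isOne i j k l | cyclesIn4-swap₂₃ i j k l = refl

    diamond-swap₃₄ : ∀ i j k l → diamond i j l k ≡ diamond i j k l
    diamond-swap₃₄ i j k l rewrite isDiamond-isOne i j l k | isDiamond-isOne i j k l | cyclesIn4-swap₃₄ i j k l = refl

    diamonds-as-sum : + diamonds t ≡ sum⁴ (λ i j k l → lt i j * lt j k * lt k l * diamond i j k l)
    diamonds-as-sum =
      trans (sumℕ≡sum λ i → sumℕ λ j → sumℕ λ k → sumℕ (counted i j k)) (sum-cong-≗ λ i →
      trans (sumℕ≡sum λ j → sumℕ λ k → sumℕ (counted i j k)) (sum-cong-≗ λ j →
      trans (sumℕ≡sum λ k → sumℕ (counted i j k)) (sum-cong-≗ λ k →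
      trans (sumℕ≡sum (counted i j k)) (sum-cong-≗ λ l →
        indicator-∧ (ltB (toℕ i) (toℕ j)) (ltB (toℕ j) (toℕ k)) (ltB (toℕ k) (toℕ l)) (isDiamond t i j k l)))))
      where
      counted : Fin n → Fin n → Fin n → Fin n → ℕ
      counted i j k l = b2n (ltB (toℕ i) (toℕ j) ∧ ltB (toℕ j) (toℕ k) ∧ ltB (toℕ k) (toℕ l) ∧ isDiamond t i j k l)
      indicator-∧ : ∀ a b c d → + b2n (a ∧ b ∧ c ∧ d) ≡ 𝟙 a * 𝟙 b * 𝟙 c * 𝟙 d
      indicator-∧ false _     _     _     = refl
      indicator-∧ true  false _     _     = refl
      indicator-∧ true  true  false _     = refl
      indicator-∧ true  true  true  false = refl
      indicator-∧ true  true  true  true  = refl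

    distinct-diamonds : sum⁴ (λ i j k l → distinct₄ i j k l * diamond i j k l) ≡ + 24 * + diamonds t
    distinct-diamonds = begin
        sum⁴ F
      ≡⟨ sum⁴-symmetric F F-swap₁₂ F-swap₂₃ F-swap₃₄ F-diagonal ⟩
        + 24 * sum⁴ (λ i j k l → lt i j * lt j k * lt k l * F i j k l)
      ≡⟨ cong (+ 24 *_) (trans (sum⁴-cong sorted) (sym diamonds-as-sum)) ⟩
        + 24 * + diamonds t ∎
      where
      open ≡-Reasoning
      F : Fin n → Fin n → Fin n → Fin n → ℤ
      F i j k l = distinct₄ i j k l * diamond i j k l
      F-swap₁₂ : ∀ i j k l → F j i k l ≡ F i j k l
      F-swap₁₂ i j k l = cong₂ _*_ (distinct₄-swap₁₂ i j k l) (diamond-swap₁₂ i j k l)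
      F-swap₂₃ : ∀ i j k l → F i k j l ≡ F i j k l
      F-swap₂₃ i j k l = cong₂ _*_ (distinct₄-swap₂₃ i j k l) (diamond-swap₂₃ i j k l)
      F-swap₃₄ : ∀ i j k l → F i j l k ≡ F i j k l
      F-swap₃₄ i j k l = cong₂ _*_ (distinct₄-swap₃₄ i j k l) (diamond-swap₃₄ i j k l)
      F-diagonal : ∀ i k l → F i i k l ≡ 0ℤ
      F-diagonal i k l rewrite δᶜ-refl i = refl
      sorted : ∀ i j k l → lt i j * lt j k * lt k l * F i j k l ≡ lt i j * lt j k * lt k l * diamond i j k l
      sorted i j k l = trans (sym (*-assoc (lt i j * lt j k * lt k l) (distinct₄ i j k l) (diamond i j k l)))
                             (cong (_* diamond i j k l) (increasing⇒distinct₄ i j k l))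

    quartet-sum :
      sum⁴ (λ i j k l → distinct₄ i j k l * (cross i j k l + cross i k j l + cross i l j k))
        ≡ sum⁴ {n} distinct₄ - + 4 * sum⁴ (λ i j k l → distinct₄ i j k l * diamond i j k l)
    quartet-sum = begin
        sum⁴ (λ i j k l → distinct₄ i j k l * (cross i j k l + cross i k j l + cross i l j k))
      ≡⟨ sum⁴-cong (λ i j k l → distinct₄-guard (cross-quartet {i} {j} {k} {l})) ⟩
        sum⁴ (λ i j k l → distinct₄ i j k l * (1ℤ - + 4 * diamond i j k l))
      ≡⟨ sum⁴-cong (λ i j k l → expand (distinct₄ i j k l) (diamond i j k l)) ⟩
        sum⁴ (λ i j k l → distinct₄ i j k l + - + 4 * (distinct₄ i j k l * diamond i j k l))
      ≡⟨ trans (sum⁴-+ {n} distinct₄ (λ i j k l → - + 4 * (distinct₄ i j k l * diamond i j k l)))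
               (cong (_+_ (sum⁴ {n} distinct₄)) (sum⁴-*ˡ (- + 4) (λ i j k l → distinct₄ i j k l * diamond i j k l))) ⟩
        sum⁴ {n} distinct₄ + - + 4 * sum⁴ (λ i j k l → distinct₄ i j k l * diamond i j k l)
      ≡⟨ subtract (sum⁴ {n} distinct₄) _ ⟩
        sum⁴ {n} distinct₄ - + 4 * sum⁴ (λ i j k l → distinct₄ i j k l * diamond i j k l) ∎
      where
      open ≡-Reasoning
      expand : ∀ d x → d * (1ℤ - + 4 * x) ≡ d + - + 4 * (d * x)
      expand = solve-∀
      subtract : ∀ a b → a + - + 4 * b ≡ a - + 4 * b
      subtract = solve-∀

    diamond-identity : + 96 * + diamonds t + + 3 * offdiag-squares ≡ + n * + n * (+ n - 1ℤ) * (+ n - + 2)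
    diamond-identity = begin
        + 96 * Δ + + 3 * offdiag-squares
      ≡⟨ cong (λ r → + 96 * Δ + + 3 * r) offdiag-squares-expansion ⟩
        + 96 * Δ + + 3 * (P₃ + X)
      ≡⟨ distribute (+ 96 * Δ) P₃ X ⟩
        + 96 * Δ + + 3 * P₃ + + 3 * X
      ≡⟨ cong (_+_ (+ 96 * Δ + + 3 * P₃)) (trans cross-pairings quartet-sum) ⟩
        + 96 * Δ + + 3 * P₃ + (sum⁴ {n} distinct₄ - + 4 * sum⁴ (λ i j k l → distinct₄ i j k l * diamond i j k l))
      ≡⟨ cong₂ (λ a b → + 96 * Δ + + 3 * P₃ + (a - + 4 * b)) (sum⁴-distinct₄ {n}) distinct-diamonds ⟩
        + 96 * Δ + + 3 * P₃ + (N * ((N - 1ℤ) * ((N - + 2) * (N - + 3))) - + 4 * (+ 24 * Δ))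
      ≡⟨ collect Δ N ⟩
        N * N * (N - 1ℤ) * (N - + 2) ∎
      where
      open ≡-Reasoning
      N Δ P₃ : ℤ
      N = + n
      Δ = + diamonds t
      P₃ = N * ((N - 1ℤ) * (N - + 2))
      X : ℤ
      X = sum⁴ (λ i j k l → distinct₄ i j k l * cross i j k l)
      distribute : ∀ a p x → a + + 3 * (p + x) ≡ a + + 3 * p + + 3 * x
      distribute = solve-∀
      collect : ∀ d N → + 96 * d + + 3 * (N * ((N - 1ℤ) * (N - + 2))) + (N * ((N - 1ℤ) * ((N - + 2) * (N - + 3))) - + 4 * (+ 24 * d))
                        ≡ N * N * (N - 1ℤ) * (N - + 2)
      collect = solve-∀

module Residues where

  open import Data.Integer using (ℤ; +_; 1ℤ; -1ℤ; _+_; _*_)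
  open import Data.Integer.Properties using (+-injective)
  open import Data.Integer.Tactic.RingSolver using (solve-∀)
  open import Data.Nat using (_%_; _<_; s≤s)
  import Data.Nat as ℕ
  import Data.Nat.Properties as ℕ
  open import Data.Nat.DivMod using (%-distribˡ-+; m*n%n≡0; m%n<n)
  open Signs

  multiple4⇒residue : ∀ n k → Multiple4 (+ n + + k) → (n % 4 ℕ.+ k % 4) % 4 ≡ 0
  multiple4⇒residue n k (q , eq) = begin
    (n % 4 ℕ.+ k % 4) % 4  ≡⟨ %-distribˡ-+ n k 4 ⟨
    (n ℕ.+ k) % 4          ≡⟨ cong (_% 4) (+-injective eq) ⟩
    (4 ℕ.* q) % 4          ≡⟨ cong (_% 4) (ℕ.*-comm 4 q) ⟩
    (q ℕ.* 4) % 4          ≡⟨ m*n%n≡0 q 4 ⟩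
    0                      ∎
    where open ≡-Reasoning

  multiple4⇒%4≡0 : ∀ n → Multiple4 (+ n) → n % 4 ≡ 0
  multiple4⇒%4≡0 n (q , eq) = trans (cong (_% 4) (+-injective eq)) (trans (cong (_% 4) (ℕ.*-comm 4 q)) (m*n%n≡0 q 4))

  residue₁ : ∀ n → Multiple4 (+ n + + 3) → n % 4 ≡ 1
  residue₁ n h = pick (n % 4) (m%n<n n 4) (multiple4⇒residue n 3 h)
    where
    pick : ∀ r → r < 4 → (r ℕ.+ 3) % 4 ≡ 0 → r ≡ 1
    pick 1 _ _ = refl
    pick 0 _ ()
    pick 2 _ ()
    pick 3 _ ()
    pick (suc (suc (suc (suc _)))) (s≤s (s≤s (s≤s (s≤s ())))) _

  residue₃ : ∀ n → Multiple4 (+ n + + 1) → n % 4 ≡ 3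
  residue₃ n h = pick (n % 4) (m%n<n n 4) (multiple4⇒residue n 1 h)
    where
    pick : ∀ r → r < 4 → (r ℕ.+ 1) % 4 ≡ 0 → r ≡ 3
    pick 3 _ _ = refl
    pick 0 _ ()
    pick 1 _ ()
    pick 2 _ ()
    pick (suc (suc (suc (suc _)))) (s≤s (s≤s (s≤s (s≤s ())))) _

  multiple4-+4 : ∀ {x} → Multiple4 x → Multiple4 (x + + 4)
  multiple4-+4 h = multiple4-+ h (1 , refl)

  triangleSign : ℕ → ℤ
  triangleSign 3 = -1ℤ
  triangleSign _ = 1ℤ

  triangleSign≡-1 : ∀ r → triangleSign r ≡ -1ℤ → r ≡ 3
  triangleSign≡-1 3 _ = refl
  triangleSign≡-1 0 ()
  triangleSign≡-1 1 ()
  triangleSign≡-1 2 ()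
  triangleSign≡-1 (suc (suc (suc (suc _)))) ()

  triangleSign-isSign : ∀ r → IsSign (triangleSign r)
  triangleSign-isSign 0 = inj₁ refl
  triangleSign-isSign 1 = inj₁ refl
  triangleSign-isSign 2 = inj₁ refl
  triangleSign-isSign 3 = inj₂ refl
  triangleSign-isSign (suc (suc (suc (suc _)))) = inj₁ refl

  private
    sum₊₊₊ : ∀ x → x + 1ℤ + 1ℤ + 1ℤ ≡ x + + 3
    sum₊₊₊ = solve-∀
    sum₊₊₋ : ∀ x → x + 1ℤ + 1ℤ + -1ℤ ≡ x + + 1
    sum₊₊₋ = solve-∀
    sum₊₋₊ : ∀ x → x + 1ℤ + -1ℤ + 1ℤ ≡ x + + 1
    sum₊₋₊ = solve-∀
    sum₋₊₊ : ∀ x → x + -1ℤ + 1ℤ + 1ℤ ≡ x + + 1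
    sum₋₊₊ = solve-∀
    sum₊₋₋ : ∀ x → x + 1ℤ + -1ℤ + -1ℤ + + 4 ≡ x + + 3
    sum₊₋₋ = solve-∀
    sum₋₊₋ : ∀ x → x + -1ℤ + 1ℤ + -1ℤ + + 4 ≡ x + + 3
    sum₋₊₋ = solve-∀
    sum₋₋₊ : ∀ x → x + -1ℤ + -1ℤ + 1ℤ + + 4 ≡ x + + 3
    sum₋₋₊ = solve-∀
    sum₋₋₋ : ∀ x → x + -1ℤ + -1ℤ + -1ℤ + + 4 ≡ x + + 1
    sum₋₋₋ = solve-∀

  signs-triangle : ∀ n {a b c} → IsSign a → IsSign b → IsSign c → Multiple4 (+ n + a + b + c) →
    a * b * c ≡ triangleSign (n % 4)
  signs-triangle n (inj₁ refl) (inj₁ refl) (inj₁ refl) h rewrite residue₁ n (subst Multiple4 (sum₊₊₊ (+ n)) h) = refl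
  signs-triangle n (inj₁ refl) (inj₁ refl) (inj₂ refl) h rewrite residue₃ n (subst Multiple4 (sum₊₊₋ (+ n)) h) = refl
  signs-triangle n (inj₁ refl) (inj₂ refl) (inj₁ refl) h rewrite residue₃ n (subst Multiple4 (sum₊₋₊ (+ n)) h) = refl
  signs-triangle n (inj₂ refl) (inj₁ refl) (inj₁ refl) h rewrite residue₃ n (subst Multiple4 (sum₋₊₊ (+ n)) h) = refl
  signs-triangle n (inj₁ refl) (inj₂ refl) (inj₂ refl) h rewrite residue₁ n (subst Multiple4 (sum₊₋₋ (+ n)) (multiple4-+4 h)) = refl
  signs-triangle n (inj₂ refl) (inj₁ refl) (inj₂ refl) h rewrite residue₁ n (subst Multiple4 (sum₋₊₋ (+ n)) (multiple4-+4 h)) = refl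
  signs-triangle n (inj₂ refl) (inj₂ refl) (inj₁ refl) h rewrite residue₁ n (subst Multiple4 (sum₋₋₊ (+ n)) (multiple4-+4 h)) = refl
  signs-triangle n (inj₂ refl) (inj₂ refl) (inj₂ refl) h rewrite residue₃ n (subst Multiple4 (sum₋₋₋ (+ n)) (multiple4-+4 h)) = refl

module Conference where

  open import Data.Integer using (ℤ; +_; 0ℤ; 1ℤ; _+_; _*_; -_; _-_)
  open import Data.Integer.Properties using (*-identityˡ; +-identityˡ)
  open import Data.Integer.Tactic.RingSolver using (solve-∀)
  open import Data.Fin.Properties using (punchInᵢ≢i; punchIn-injective)
  open import Data.Nat using (_%_; _∸_)
  import Data.Nat as ℕ
  open Sums
  open Signs
  open SkewSignMatrices
  open Residues

  private
    pred-ℤ : ∀ {m} → Fin m → + m - 1ℤ ≡ + (m ∸ 1)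
    pred-ℤ {suc m} _ = refl

  module _ {m : ℕ} {C : Fin m → Fin m → ℤ} (isConference : IsSkewConference m C) where

    open IsSkewConference isConference

    skewConference⇒skewSign : IsSkewSignMatrix m C
    skewConference⇒skewSign = record { diag0 = diag0 ; offdiag = offdiag ; skew = skew }

    skewConference-gram : ∀ i j → gram C i j ≡ δ i j * + (m ∸ 1)
    skewConference-gram i j = trans (sym (sumℤ≡sum (λ k → C i k * C j k))) (trans (orth i j) (if-δ i j _))

    skewConference-offdiag : ∀ {i j} → i ≢ j → gram C i j ≡ 0ℤ
    skewConference-offdiag {i} {j} i≢j = trans (skewConference-gram i j) (cong (_* + (m ∸ 1)) (δ-≢ i≢j))

  skewConference-%4 : ∀ {m} {C : Fin m → Fin m → ℤ} → 3 ℕ.≤ m → IsSkewConference m C → m % 4 ≡ 0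
  skewConference-%4 {suc (suc (suc k))} (ℕ.s≤s (ℕ.s≤s (ℕ.s≤s _))) isConference =
    multiple4⇒%4≡0 (suc (suc (suc k)))
      (subst Multiple4 (trans (cong₃ (λ a b c → + suc (suc (suc k)) + a + b + c)
                                      (skewConference-offdiag isConference 0≢1)
                                      (skewConference-offdiag isConference 0≢2)
                                      (skewConference-offdiag isConference 1≢2))
                               (zeros (+ suc (suc (suc k)))))
        (SkewSign.gram-triangle (skewConference⇒skewSign isConference) 0≢1 0≢2 1≢2))
    where
    0≢1 : zero ≢ suc zero
    0≢1 ()
    0≢2 : zero ≢ suc (suc zero)
    0≢2 ()
    1≢2 : suc zero ≢ suc (suc zero)
    1≢2 ()
    zeros : ∀ x → x + 0ℤ + 0ℤ + 0ℤ ≡ x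
    zeros = solve-∀

  gram-offdiag-zero⇒skewConference : ∀ {m} {A : Fin m → Fin m → ℤ} → IsSkewSignMatrix m A →
    (∀ i j → i ≢ j → gram A i j ≡ 0ℤ) → IsSkewConference m A
  gram-offdiag-zero⇒skewConference {m} {A} isSkewSign offdiag-zero = record
    { diag0   = diag0
    ; offdiag = offdiag
    ; skew    = skew
    ; orth    = λ i j → trans (sumℤ≡sum (λ k → A i k * A j k)) (trans (gram≡ i j) (sym (if-δ i j _)))
    }
    where
    open SkewSign isSkewSign
    gram≡ : ∀ i j → gram A i j ≡ δ i j * + (m ∸ 1)
    gram≡ i j with i ≟ j
    ... | yes refl = trans (gram-diag i) (trans (pred-ℤ i) (sym (*-identityˡ _)))
    ... | no i≢j = offdiag-zero i j i≢j

  deleted⇒gram-sign : ∀ {n} {S : Fin n → Fin n → ℤ} → DeletedSkewConference n S → ∀ {i j} → i ≢ j → IsSign (gram S i j)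
  deleted⇒gram-sign {n} {S} (C , isConference , r , S≡C) {i} {j} i≢j =
    subst IsSign (sym gram≡) (isSign-neg (isSign-* (offdiag _ _ (punchInᵢ≢i r i)) (offdiag _ _ (punchInᵢ≢i r j))))
    where
    open IsSkewConference isConference
    i′ j′ : Fin (suc n)
    i′ = punchIn r i
    j′ = punchIn r j
    border+gram : C i′ r * C j′ r + gram S i j ≡ 0ℤ
    border+gram = begin
      C i′ r * C j′ r + gram S i j                                  ≡⟨ cong (_+_ (C i′ r * C j′ r)) (sum-cong-≗ λ k → cong₂ _*_ (S≡C i k) (S≡C j k)) ⟩
      C i′ r * C j′ r + sum (λ k → C i′ (punchIn r k) * C j′ (punchIn r k))  ≡⟨ sum-remove {i = r} (λ k → C i′ k * C j′ k) ⟨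
      gram C i′ j′                                                  ≡⟨ skewConference-offdiag isConference (i≢j ∘ punchIn-injective r i j) ⟩
      0ℤ                                                            ∎
      where open ≡-Reasoning
    gram≡ : gram S i j ≡ - (C i′ r * C j′ r)
    gram≡ = solve-for (C i′ r * C j′ r) (gram S i j) border+gram
      where
      solve-for : ∀ a b → a + b ≡ 0ℤ → b ≡ - a
      solve-for a b a+b≡0 = trans (sym (cancel a b)) (trans (cong (_+ - a) a+b≡0) (+-identityˡ (- a)))
        where
        cancel : ∀ a b → a + b + - a ≡ b
        cancel = solve-∀

module Bordering where

  open import Data.Integer using (ℤ; +_; 0ℤ; 1ℤ; -1ℤ; _+_; _*_; -_; _-_)
  open import Data.Integer.Properties
    using (*-identityˡ; *-identityʳ; *-comm; *-zeroʳ; +-identityˡ; +-inverseʳ; *-cancelˡ-≡; *-cancelʳ-≡; +-injective; neg-involutive)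
  open import Data.Integer.Tactic.RingSolver using (solve-∀)
  import Data.Nat as ℕ
  import Data.Nat.Properties as ℕ
  open import Data.Nat using (_∸_)
  open import Data.Sum using ([_,_]′)
  open import Function using (id)
  open Sums
  open Signs
  open SkewSignMatrices

  module _ {k : ℕ} {S : Fin (suc (suc k)) → Fin (suc (suc k)) → ℤ} (isSkewSign : IsSkewSignMatrix (suc (suc k)) S)
    (gram-sign : ∀ {i j} → i ≢ j → IsSign (gram S i j))
    (ε : ℤ) (ε-sign : IsSign ε)
    (triangle : ∀ {i j l} → i ≢ j → i ≢ l → j ≢ l → gram S i j * gram S i l * gram S j l ≡ ε) where

    open SkewSign isSkewSign

    private
      n : ℕ
      n = suc (suc k)
      N : ℤ
      N = + n
      G : Fin n → Fin n → ℤ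
      G = gram S

    ε² : ε * ε ≡ 1ℤ
    ε² = isSign-square ε-sign

    border : Fin n → ℤ
    border zero    = 1ℤ
    border (suc i) = ε * G (suc i) zero

    border-sign : ∀ i → IsSign (border i)
    border-sign zero    = inj₁ refl
    border-sign (suc i) = isSign-* ε-sign (gram-sign λ ())

    border² : ∀ i → border i * border i ≡ 1ℤ
    border² i = isSign-square (border-sign i)

    gram-offdiag-border : ∀ {i j} → i ≢ j → G i j ≡ ε * (border i * border j)
    gram-offdiag-border {zero} {zero} 0≢0 = ⊥-elim (0≢0 refl)
    gram-offdiag-border {zero} {suc j} _ = sym (begin
        ε * (1ℤ * (ε * G (suc j) zero))  ≡⟨ regroup ε (G (suc j) zero) ⟩
        ε * ε * G (suc j) zero           ≡⟨ cong (_* G (suc j) zero) ε² ⟩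
        1ℤ * G (suc j) zero              ≡⟨ *-identityˡ _ ⟩
        G (suc j) zero                   ≡⟨ gram-sym (suc j) zero ⟩
        G zero (suc j)                   ∎)
      where
      open ≡-Reasoning
      regroup : ∀ e a → e * (1ℤ * (e * a)) ≡ e * e * a
      regroup = solve-∀
    gram-offdiag-border {suc i} {zero} _ = sym (begin
        ε * (ε * G (suc i) zero * 1ℤ)  ≡⟨ regroup ε (G (suc i) zero) ⟩
        ε * ε * G (suc i) zero         ≡⟨ cong (_* G (suc i) zero) ε² ⟩
        1ℤ * G (suc i) zero            ≡⟨ *-identityˡ _ ⟩
        G (suc i) zero                 ∎)
      where
      open ≡-Reasoning
      regroup : ∀ e a → e * (e * a * 1ℤ) ≡ e * e * a
      regroup = solve-∀
    gram-offdiag-border {suc i} {suc j} i≢j = begin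
        G (suc i) (suc j)
      ≡⟨ sym (trans (cong₂ (λ u v → G (suc i) (suc j) * u * v) (isSign-square (gram-sign λ ())) (isSign-square (gram-sign λ ())))
                    (unit (G (suc i) (suc j)))) ⟩
        G (suc i) (suc j) * (a * a) * (b * b)
      ≡⟨ regroup (G (suc i) (suc j)) a b ⟩
        G (suc i) (suc j) * a * b * (a * b)
      ≡⟨ cong (_* (a * b)) (triangle i≢j (λ ()) (λ ())) ⟩
        ε * (a * b)
      ≡⟨ sym (trans (expand ε a b) (trans (cong (λ e → e * ε * (a * b)) ε²) (cong (_* (a * b)) (*-identityˡ ε)))) ⟩
        ε * (ε * a * (ε * b)) ∎
      where
      open ≡-Reasoning
      a b : ℤ
      a = G (suc i) zero
      b = G (suc j) zero
      unit : ∀ g → g * 1ℤ * 1ℤ ≡ g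
      unit = solve-∀
      regroup : ∀ g a b → g * (a * a) * (b * b) ≡ g * a * b * (a * b)
      regroup = solve-∀
      expand : ∀ e a b → e * (e * a * (e * b)) ≡ e * e * e * (a * b)
      expand = solve-∀

    private
      c : ℤ
      c = N - 1ℤ - ε

    gram-decomposition : ∀ i j → G i j ≡ δ i j * c + ε * (border i * border j)
    gram-decomposition i j with i ≟ j
    ... | yes refl rewrite border² i = trans (gram-diag i) (diagonal N ε)
      where
      diagonal : ∀ N e → N - 1ℤ ≡ 1ℤ * (N - 1ℤ - e) + e * 1ℤ
      diagonal = solve-∀
    ... | no i≢j = trans (gram-offdiag-border i≢j) (sym (+-identityˡ _))

    gram-border : ∀ i → sum (λ j → G i j * border j) ≡ (c + ε * N) * border i
    gram-border i = begin
        sum (λ j → G i j * border j)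
      ≡⟨ sum-cong-≗ (λ j → trans (cong (_* border j) (gram-decomposition i j))
           (trans (expand (δ i j) c ε (border i) (border j)) (cong (λ z → δ i j * (c * border j) + ε * border i * z) (border² j)))) ⟩
        sum (λ j → δ i j * (c * border j) + ε * border i * 1ℤ)
      ≡⟨ ∑-distrib-+ (λ j → δ i j * (c * border j)) (λ _ → ε * border i * 1ℤ) ⟩
        sum (λ j → δ i j * (c * border j)) + sum {n} (λ _ → ε * border i * 1ℤ)
      ≡⟨ cong₂ _+_ (sum-δ i (λ j → c * border j)) (sum-const {n} (ε * border i * 1ℤ)) ⟩
        c * border i + N * (ε * border i * 1ℤ)
      ≡⟨ collect c N ε (border i) ⟩
        (c + ε * N) * border i ∎
      where
      open ≡-Reasoning
      expand : ∀ d c e a b → (d * c + e * (a * b)) * b ≡ d * (c * b) + e * a * (b * b)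
      expand = solve-∀
      collect : ∀ c N e a → c * a + N * (e * a * 1ℤ) ≡ (c + e * N) * a
      collect = solve-∀

    S·border : Fin n → ℤ
    S·border i = sum λ k → S i k * border k

    S·border-norm : sum (λ i → S·border i * S·border i) ≡ (c + ε * N) * N
    S·border-norm = begin
        sum (λ i → S·border i * S·border i)
      ≡⟨ sum-cong-≗ (λ i → trans (sym (sum-*ʳ (S·border i) (λ k → S i k * border k)))
                                  (sum-cong-≗ λ k → sym (sum-*ˡ (S i k * border k) (λ l → S i l * border l)))) ⟩
        (sum λ i → sum λ k → sum λ l → S i k * border k * (S i l * border l))
      ≡⟨ ∑-comm (λ i k → sum λ l → S i k * border k * (S i l * border l)) ⟩
        (sum λ k → sum λ i → sum λ l → S i k * border k * (S i l * border l))
      ≡⟨ sum-cong-≗ (λ k → ∑-comm (λ i l → S i k * border k * (S i l * border l))) ⟩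
        (sum λ k → sum λ l → sum λ i → S i k * border k * (S i l * border l))
      ≡⟨ sum-cong-≗ (λ k → sum-cong-≗ λ l →
           trans (sum-cong-≗ λ i → regroup (S i k) (border k) (S i l) (border l))
                 (trans (sum-*ˡ (border k * border l) (λ i → S i k * S i l)) (cong (border k * border l *_) (gram-columns k l)))) ⟩
        (sum λ k → sum λ l → border k * border l * G k l)
      ≡⟨ sum-cong-≗ (λ k → trans (sum-cong-≗ λ l → regroup′ (border k) (border l) (G k l))
                                   (trans (sum-*ˡ (border k) (λ l → G k l * border l))
                                          (cong (border k *_) (gram-border k)))) ⟩
        sum (λ k → border k * ((c + ε * N) * border k))
      ≡⟨ sum-cong-≗ (λ k → trans (swap (border k) (c + ε * N)) (cong ((c + ε * N) *_) (border² k))) ⟩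
        sum {n} (λ _ → (c + ε * N) * 1ℤ)
      ≡⟨ trans (sum-const {n} ((c + ε * N) * 1ℤ)) (commute N (c + ε * N)) ⟩
        (c + ε * N) * N ∎
      where
      open ≡-Reasoning
      regroup : ∀ a b c d → a * b * (c * d) ≡ b * d * (a * c)
      regroup = solve-∀
      regroup′ : ∀ a b g → a * b * g ≡ a * (g * b)
      regroup′ = solve-∀
      swap : ∀ a b → a * (b * a) ≡ b * (a * a)
      swap = solve-∀
      commute : ∀ N a → N * (a * 1ℤ) ≡ a * N
      commute = solve-∀

    border⊥S·border : sum (λ j → border j * S·border j) ≡ 0ℤ
    border⊥S·border = self-negating (begin
        sum (λ j → border j * S·border j)
      ≡⟨ expanded ⟩
        (sum λ j → sum λ l → border j * (S j l * border l))
      ≡⟨ ∑-comm (λ j l → border j * (S j l * border l)) ⟩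
        (sum λ l → sum λ j → border j * (S j l * border l))
      ≡⟨ sum-cong-≗ (λ l → trans (sum-cong-≗ λ j → trans (cong (λ z → border j * (z * border l)) (skew l j))
                                                             (flip (border j) (S l j) (border l)))
                                  (sum-neg (λ j → border l * (S l j * border j)))) ⟩
        sum (λ l → - sum (λ j → border l * (S l j * border j)))
      ≡⟨ sum-neg (λ l → sum λ j → border l * (S l j * border j)) ⟩
        - (sum λ l → sum λ j → border l * (S l j * border j))
      ≡⟨ cong -_ (sym expanded) ⟩
        - sum (λ j → border j * S·border j) ∎)
      where
      open ≡-Reasoning
      expanded : sum (λ j → border j * S·border j) ≡ (sum λ j → sum λ l → border j * (S j l * border l))
      expanded = sum-cong-≗ λ j → sym (sum-*ˡ (border j) (λ l → S j l * border l))
      flip : ∀ a b c → a * (- b * c) ≡ - (c * (b * a))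
      flip = solve-∀
      self-negating : ∀ {x} → x ≡ - x → x ≡ 0ℤ
      self-negating {x} x≡-x = *-cancelˡ-≡ (+ 2) x 0ℤ (trans (double x) (trans (cong (_+_ x) x≡-x) (+-inverseʳ x)))
        where
        double : ∀ x → + 2 * x ≡ x + x
        double = solve-∀

    gram-S·border : ∀ i → sum (λ j → G i j * S·border j) ≡ c * S·border i
    gram-S·border i = begin
        sum (λ j → G i j * S·border j)
      ≡⟨ sum-cong-≗ (λ j → trans (cong (_* S·border j) (gram-decomposition i j)) (expand (δ i j) c ε (border i) (border j) (S·border j))) ⟩
        sum (λ j → δ i j * (c * S·border j) + ε * border i * (border j * S·border j))
      ≡⟨ ∑-distrib-+ (λ j → δ i j * (c * S·border j)) (λ j → ε * border i * (border j * S·border j)) ⟩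
        sum (λ j → δ i j * (c * S·border j)) + sum (λ j → ε * border i * (border j * S·border j))
      ≡⟨ cong₂ _+_ (sum-δ i (λ j → c * S·border j))
           (trans (sum-*ˡ (ε * border i) (λ j → border j * S·border j)) (cong (ε * border i *_) border⊥S·border)) ⟩
        c * S·border i + ε * border i * 0ℤ
      ≡⟨ drop (c * S·border i) (ε * border i) ⟩
        c * S·border i ∎
      where
      open ≡-Reasoning
      expand : ∀ d c e a b r → (d * c + e * (a * b)) * r ≡ d * (c * r) + e * a * (b * r)
      expand = solve-∀
      drop : ∀ a b → a + b * 0ℤ ≡ a
      drop = solve-∀

    gram-S·border′ : ∀ i → sum (λ j → G i j * S·border j) ≡ (c + ε * N) * S·border i
    gram-S·border′ i = begin
        sum (λ j → G i j * S·border j)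
      ≡⟨ sum-cong-≗ (λ j → trans (sym (sum-*ʳ (S·border j) (λ l → S i l * S j l)))
                                  (sum-cong-≗ λ l → sym (sum-*ˡ (S i l * S j l) (λ m → S j m * border m)))) ⟩
        (sum λ j → sum λ l → sum λ m → S i l * S j l * (S j m * border m))
      ≡⟨ ∑-comm (λ j l → sum λ m → S i l * S j l * (S j m * border m)) ⟩
        (sum λ l → sum λ j → sum λ m → S i l * S j l * (S j m * border m))
      ≡⟨ sum-cong-≗ (λ l → ∑-comm (λ j m → S i l * S j l * (S j m * border m))) ⟩
        (sum λ l → sum λ m → sum λ j → S i l * S j l * (S j m * border m))
      ≡⟨ sum-cong-≗ (λ l → trans (sum-cong-≗ λ m →
              trans (sum-cong-≗ λ j → regroup (S i l) (S j l) (S j m) (border m))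
                    (trans (sum-*ˡ (S i l * border m) (λ j → S j l * S j m)) (cong (S i l * border m *_) (gram-columns l m))))
            (trans (sum-cong-≗ λ m → regroup′ (S i l) (border m) (G l m))
                   (trans (sum-*ˡ (S i l) (λ m → G l m * border m)) (cong (S i l *_) (gram-border l))))) ⟩
        sum (λ l → S i l * ((c + ε * N) * border l))
      ≡⟨ trans (sum-cong-≗ λ l → swap (S i l) (c + ε * N) (border l)) (sum-*ˡ (c + ε * N) (λ l → S i l * border l)) ⟩
        (c + ε * N) * S·border i ∎
      where
      open ≡-Reasoning
      regroup : ∀ a b d e → a * b * (d * e) ≡ a * e * (b * d)
      regroup = solve-∀
      regroup′ : ∀ a e g → a * e * g ≡ a * (g * e)
      regroup′ = solve-∀
      swap : ∀ a b c → a * (b * c) ≡ b * (a * c)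
      swap = solve-∀

    -- S·border is an eigenvector of the Gram matrix for both c and c + εN.
    S·border≡0 : ∀ i → S·border i ≡ 0ℤ
    S·border≡0 i = *-cancelˡ-≡ N (S·border i) 0ℤ (begin
        N * S·border i                 ≡⟨ unit-ε N (S·border i) ε² ⟩
        ε * ((c + ε * N) * S·border i - c * S·border i)  ≡⟨ cong (λ z → ε * (z - c * S·border i)) (trans (sym (gram-S·border′ i)) (gram-S·border i)) ⟩
        ε * (c * S·border i - c * S·border i) ≡⟨ cancel ε (c * S·border i) ⟩
        0ℤ                       ≡⟨ sym (*-zeroʳ N) ⟩
        N * 0ℤ                   ∎)
      where
      open ≡-Reasoning
      unit-ε : ∀ N r → ε * ε ≡ 1ℤ → N * r ≡ ε * ((c + ε * N) * r - c * r)
      unit-ε N r e² = begin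
        N * r                          ≡⟨ *-identityˡ (N * r) ⟨
        1ℤ * (N * r)                   ≡⟨ cong (_* (N * r)) e² ⟨
        ε * ε * (N * r)                ≡⟨ expand ε c N r ⟩
        ε * ((c + ε * N) * r - c * r)  ∎
        where
        expand : ∀ e c N r → e * e * (N * r) ≡ e * ((c + e * N) * r - c * r)
        expand = solve-∀
      cancel : ∀ e x → e * (x - x) ≡ 0ℤ
      cancel = solve-∀

    eigenvalue-zero : c + ε * N ≡ 0ℤ
    eigenvalue-zero = *-cancelʳ-≡ (c + ε * N) 0ℤ N (begin
      (c + ε * N) * N          ≡⟨ S·border-norm ⟨
      sum (λ i → S·border i * S·border i)  ≡⟨ sum-cong-≗ (λ i → cong (λ z → z * z) (S·border≡0 i)) ⟩
      sum {n} (λ _ → 0ℤ)       ≡⟨ sum-replicate-zero n ⟩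
      0ℤ                       ∎)
      where open ≡-Reasoning

    -- For ε = 1 the vanishing eigenvalue c + εN would be 2N - 2.
    ε≡-1 : ε ≡ -1ℤ
    ε≡-1 = [ (λ ε≡1 → ⊥-elim (ℕ.m+1+n≢0 k (+-injective (subst (λ e → N - 1ℤ - e + e * N ≡ 0ℤ) ε≡1 eigenvalue-zero)))) , id ]′ ε-sign

    bordered : Fin (suc n) → Fin (suc n) → ℤ
    bordered zero    zero    = 0ℤ
    bordered zero    (suc j) = - border j
    bordered (suc i) zero    = border i
    bordered (suc i) (suc j) = S i j

    private
      border-gram : ∀ i j → border i * border j + G i j ≡ δ i j * N
      border-gram i j = trans (cong (_+_ (border i * border j)) (gram-decomposition i j))
                              (collapse (border i * border j) (δ i j) N ε ε≡-1)
        where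
        collapse : ∀ a d N e → e ≡ -1ℤ → a + (d * (N - 1ℤ - e) + e * a) ≡ d * N
        collapse a d N e refl = simplify a d N
          where
          simplify : ∀ a d N → a + (d * (N - 1ℤ - -1ℤ) + -1ℤ * a) ≡ d * N
          simplify = solve-∀

      neg-S·border : ∀ i → sumℤ (λ k → S i k * - border k) ≡ 0ℤ
      neg-S·border i = trans (sumℤ≡sum (λ k → S i k * - border k))
                       (trans (sum-cong-≗ λ k → move (S i k) (border k)) (trans (sum-neg (λ k → S i k * border k)) (cong -_ (S·border≡0 i))))
        where
        move : ∀ a b → a * - b ≡ - (a * b)
        move = solve-∀

    bordered-orth : ∀ i j → sumℤ (λ l → bordered i l * bordered j l) ≡ (if ⌊ i ≟ j ⌋ then + (suc n ∸ 1) else 0ℤ)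
    bordered-orth zero zero = trans (+-identityˡ _) (trans (sumℤ≡sum (λ l → - border l * - border l))
      (trans (sum-cong-≗ λ l → trans (neg² (border l)) (border² l)) (trans (sum-const {n} 1ℤ) (*-identityʳ N))))
      where
      neg² : ∀ a → - a * - a ≡ a * a
      neg² = solve-∀
    bordered-orth zero (suc j) = trans (+-identityˡ _) (trans (sumℤ≡sum (λ l → - border l * S j l))
      (trans (sum-cong-≗ λ l → *-comm (- border l) (S j l)) (trans (sym (sumℤ≡sum (λ l → S j l * - border l))) (neg-S·border j))))
    bordered-orth (suc i) zero = trans (cong (_+ sumℤ (λ l → S i l * - border l)) (*-zeroʳ (border i)))
                                       (trans (+-identityˡ _) (neg-S·border i))
    bordered-orth (suc i) (suc j) = trans (cong (_+_ (border i * border j)) (sumℤ≡sum (λ l → S i l * S j l)))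
                                          (trans (border-gram i j) (suc-δ i j))
      where
      suc-δ : ∀ i j → δ i j * N ≡ (if ⌊ suc i ≟ suc j ⌋ then N else 0ℤ)
      suc-δ i j with i ≟ j
      ... | yes refl = *-identityˡ N
      ... | no _ = refl

    bordered-isSkewConference : IsSkewConference (suc n) bordered
    bordered-isSkewConference = record
      { diag0   = diag0′
      ; offdiag = offdiag′
      ; skew    = skew′
      ; orth    = bordered-orth
      }
      where
      diag0′ : ∀ i → bordered i i ≡ 0ℤ
      diag0′ zero    = refl
      diag0′ (suc i) = diag0 i
      offdiag′ : ∀ i j → i ≢ j → IsSign (bordered i j)
      offdiag′ zero    zero    0≢0 = ⊥-elim (0≢0 refl)
      offdiag′ zero    (suc j) _   = isSign-neg (border-sign j)
      offdiag′ (suc i) zero    _   = border-sign i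
      offdiag′ (suc i) (suc j) i≢j = offdiag i j (i≢j ∘ cong suc)
      skew′ : ∀ i j → bordered j i ≡ - bordered i j
      skew′ zero    zero    = refl
      skew′ zero    (suc j) = sym (neg-involutive (border j))
      skew′ (suc i) zero    = refl
      skew′ (suc i) (suc j) = skew i j

    deleted : DeletedSkewConference n S
    deleted = bordered , bordered-isSkewConference , zero , λ i j → refl

  bordering : ∀ {n} {S : Fin n → Fin n → ℤ} → 2 ℕ.≤ n → IsSkewSignMatrix n S →
    (∀ {i j} → i ≢ j → IsSign (gram S i j)) →
    ∀ {ε} → IsSign ε → (∀ {i j l} → i ≢ j → i ≢ l → j ≢ l → gram S i j * gram S i l * gram S j l ≡ ε) →
    ε ≡ -1ℤ × DeletedSkewConference n S
  bordering (ℕ.s≤s (ℕ.s≤s _)) isSkewSign gram-sign {ε} ε-sign triangle =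
    ε≡-1 isSkewSign gram-sign ε ε-sign triangle , deleted isSkewSign gram-sign ε ε-sign triangle

module DiamondBound where

  open import Data.Integer using (ℤ; +_; 0ℤ; 1ℤ; _+_; _*_; _-_)
  open import Data.Integer.Properties using (+-injective; pos-+; pos-*; ⊖-≥; m-n≡m⊖n)
  open import Data.Integer.Tactic.RingSolver using (solve-∀)
  open import Data.Nat using (_%_; _∸_; _≤_)
  open import Data.Product using (map₁; map₂)
  import Data.Nat as ℕ
  import Data.Nat.Properties as ℕ
  open import Data.Nat.DivMod using (m*n%n≡0)
  open import Function.Bundles using (_⇔_; mk⇔)
  open import Function.Construct.Composition using (_⇔-∘_)
  open Sums
  open Signs
  open SkewSignMatrices
  open Tournaments
  open Conference
  open Residues
  open Bordering

  bound-and-equality : ∀ {a b r} → a ℕ.+ 3 ℕ.* r ≡ b → a ≤ b × (a ≡ b ⇔ r ≡ 0)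
  bound-and-equality {a} {r = r} refl = ℕ.m≤m+n a (3 ℕ.* r) , mk⇔ to from
    where
    3r≡0 : ∀ r → 0 ≡ 3 ℕ.* r → r ≡ 0
    3r≡0 zero _ = refl
    to : a ≡ a ℕ.+ 3 ℕ.* r → r ≡ 0
    to eq = 3r≡0 r (ℕ.+-cancelˡ-≡ a 0 (3 ℕ.* r) (trans (ℕ.+-identityʳ a) eq))
    from : r ≡ 0 → a ≡ a ℕ.+ 3 ℕ.* r
    from refl = sym (ℕ.+-identityʳ a)

  nonneg-zero⇔ : ∀ {z} (z≥0 : Nonneg z) → proj₁ z≥0 ≡ 0 ⇔ z ≡ 0ℤ
  nonneg-zero⇔ (k , refl) = mk⇔ (cong (λ m → + m)) +-injective

  pos-*⁴ : ∀ a b c d → + (a ℕ.* b ℕ.* c ℕ.* d) ≡ + a * + b * + c * + d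
  pos-*⁴ a b c d = trans (pos-* (a ℕ.* b ℕ.* c) d) (cong (_* + d) (trans (pos-* (a ℕ.* b) c) (cong (_* + c) (pos-* a b))))

  pos-∸ : ∀ {m n} → m ≤ n → + (n ∸ m) ≡ + n - + m
  pos-∸ {m} {n} m≤n = trans (sym (⊖-≥ m≤n)) (sym (m-n≡m⊖n n m))

  ℤ-count⇒ℕ-count : ∀ Δ r b → + 96 * + Δ + + 3 * + r ≡ + b → 96 ℕ.* Δ ℕ.+ 3 ℕ.* r ≡ b
  ℤ-count⇒ℕ-count Δ r b eq =
    +-injective (trans (pos-+ (96 ℕ.* Δ) (3 ℕ.* r)) (trans (cong₂ _+_ (pos-* 96 Δ) (pos-* 3 r)) eq))

  module _ {n : ℕ} (t : Tournament n) (3≤n : 3 ≤ n) where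

    private
      N : ℤ
      N = + n
      1≤n : 1 ≤ n
      1≤n = ℕ.≤-trans (ℕ.s≤s ℕ.z≤n) 3≤n
      2≤n : 2 ≤ n
      2≤n = ℕ.≤-trans (ℕ.s≤s (ℕ.s≤s ℕ.z≤n)) 3≤n

    open SkewSign (seidel-isSkewSign t)

    squares-nonneg : Nonneg offdiag-squares
    squares-nonneg = offdiag-sum-nonneg λ {i} {j} _ → nonneg-square (gram (seidel t) i j)

    even-count : 96 ℕ.* diamonds t ℕ.+ 3 ℕ.* proj₁ squares-nonneg ≡ n ℕ.* n ℕ.* (n ∸ 1) ℕ.* (n ∸ 2)
    even-count = ℤ-count⇒ℕ-count (diamonds t) (proj₁ squares-nonneg) _
      (trans (cong (λ z → + 96 * + diamonds t + + 3 * z) (sym (proj₂ squares-nonneg)))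
             (trans (diamond-identity t) (sym (trans (pos-*⁴ n n (n ∸ 1) (n ∸ 2))
                                                      (cong₂ (λ a b → N * N * a * b) (pos-∸ 1≤n) (pos-∸ 2≤n))))))

    squares-zero⇔conference : offdiag-squares ≡ 0ℤ ⇔ (n % 4 ≡ 0 × IsSkewConference n (seidel t))
    squares-zero⇔conference = mk⇔ to from
      where
      to : offdiag-squares ≡ 0ℤ → n % 4 ≡ 0 × IsSkewConference n (seidel t)
      to squares≡0 = skewConference-%4 3≤n conference , conference
        where
        conference : IsSkewConference n (seidel t)
        conference = gram-offdiag-zero⇒skewConference (seidel-isSkewSign t) λ i j i≢j →
          square≡0 (gram (seidel t) i j) (offdiag-sum-zero (λ {i} {j} _ → nonneg-square (gram (seidel t) i j)) squares≡0 i≢j)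
      from : n % 4 ≡ 0 × IsSkewConference n (seidel t) → offdiag-squares ≡ 0ℤ
      from (_ , conference) = offdiag-sum-vanishes λ {i} {j} i≢j →
        cong (λ z → z * z) (skewConference-offdiag conference i≢j)

    even-case : 96 ℕ.* diamonds t ≤ n ℕ.* n ℕ.* (n ∸ 1) ℕ.* (n ∸ 2)
      × (96 ℕ.* diamonds t ≡ n ℕ.* n ℕ.* (n ∸ 1) ℕ.* (n ∸ 2) ⇔ (n % 4 ≡ 0 × IsSkewConference n (seidel t)))
    even-case = map₂ (λ equality → squares-zero⇔conference ⇔-∘ (nonneg-zero⇔ squares-nonneg ⇔-∘ equality))
                     (bound-and-equality {r = proj₁ squares-nonneg} even-count)

    module _ (odd : n % 2 ≡ 1) where

      private
        gram-nonzero : ∀ {i j} → i ≢ j → gram (seidel t) i j ≢ 0ℤ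
        gram-nonzero i≢j G≡0 with gram-parity i≢j
        ... | c , eq = 0≢1 (trans (sym (trans (cong (_% 2) (ℕ.*-comm 2 c)) (m*n%n≡0 c 2)))
                                   (trans (cong (_% 2) (+-injective (trans (cong (_+ + (2 ℕ.* c)) (sym G≡0)) eq))) odd))
          where
          0≢1 : 0 ≢ 1
          0≢1 ()

        pred-square-nonneg : ∀ {i j} → i ≢ j → Nonneg (gram (seidel t) i j * gram (seidel t) i j - 1ℤ)
        pred-square-nonneg {i} {j} i≢j with nonzero-square (gram (seidel t) i j) (gram-nonzero i≢j)
        ... | l , eq = l , cong (_- 1ℤ) eq

      pred-squares : ℤ
      pred-squares = offdiag-sum λ i j → gram (seidel t) i j * gram (seidel t) i j - 1ℤ

      pred-squares-nonneg : Nonneg pred-squares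
      pred-squares-nonneg = offdiag-sum-nonneg pred-square-nonneg

      odd-count : 96 ℕ.* diamonds t ℕ.+ 3 ℕ.* proj₁ pred-squares-nonneg ≡ n ℕ.* (n ∸ 1) ℕ.* (n ∸ 3) ℕ.* (n ℕ.+ 1)
      odd-count = ℤ-count⇒ℕ-count (diamonds t) (proj₁ pred-squares-nonneg) _ (begin
          + 96 * Δ + + 3 * + proj₁ pred-squares-nonneg
        ≡⟨ cong (λ z → + 96 * Δ + + 3 * z) (sym (proj₂ pred-squares-nonneg)) ⟩
          + 96 * Δ + + 3 * pred-squares
        ≡⟨ cong (λ z → + 96 * Δ + + 3 * z) (offdiag-sum-pred (λ i j → gram (seidel t) i j * gram (seidel t) i j)) ⟩
          + 96 * Δ + + 3 * (offdiag-squares - N * (N - 1ℤ))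
        ≡⟨ distribute (+ 96 * Δ) offdiag-squares (N * (N - 1ℤ)) ⟩
          + 96 * Δ + + 3 * offdiag-squares - + 3 * (N * (N - 1ℤ))
        ≡⟨ cong (_- + 3 * (N * (N - 1ℤ))) (diamond-identity t) ⟩
          N * N * (N - 1ℤ) * (N - + 2) - + 3 * (N * (N - 1ℤ))
        ≡⟨ factor N ⟩
          N * (N - 1ℤ) * (N - + 3) * (N + 1ℤ)
        ≡⟨ trans (pos-*⁴ n (n ∸ 1) (n ∸ 3) (n ℕ.+ 1)) (cong₂ (λ a b → N * a * b * (N + 1ℤ)) (pos-∸ 1≤n) (pos-∸ 3≤n)) ⟨
          + (n ℕ.* (n ∸ 1) ℕ.* (n ∸ 3) ℕ.* (n ℕ.+ 1)) ∎)
        where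
        open ≡-Reasoning
        Δ : ℤ
        Δ = + diamonds t
        distribute : ∀ a r p → a + + 3 * (r - p) ≡ a + + 3 * r - + 3 * p
        distribute = solve-∀
        factor : ∀ N → N * N * (N - 1ℤ) * (N - + 2) - + 3 * (N * (N - 1ℤ)) ≡ N * (N - 1ℤ) * (N - + 3) * (N + 1ℤ)
        factor = solve-∀

      pred-squares-zero⇔deleted : pred-squares ≡ 0ℤ ⇔ (n % 4 ≡ 3 × DeletedSkewConference n (seidel t))
      pred-squares-zero⇔deleted = mk⇔ to from
        where
        to : pred-squares ≡ 0ℤ → n % 4 ≡ 3 × DeletedSkewConference n (seidel t)
        to pred-squares≡0 =
          map₁ (triangleSign≡-1 (n % 4)) (bordering 2≤n (seidel-isSkewSign t) signs (triangleSign-isSign (n % 4)) triangle)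
          where
          signs : ∀ {i j} → i ≢ j → IsSign (gram (seidel t) i j)
          signs {i} {j} i≢j = square≡1⇒isSign (gram (seidel t) i j)
            (pred≡0 (offdiag-sum-zero pred-square-nonneg pred-squares≡0 i≢j))
            where
            pred≡0 : ∀ {z} → z - 1ℤ ≡ 0ℤ → z ≡ 1ℤ
            pred≡0 {z} eq = trans (sym (shift z)) (cong (_+ 1ℤ) eq)
              where
              shift : ∀ z → z - 1ℤ + 1ℤ ≡ z
              shift = solve-∀
          triangle : ∀ {i j l} → i ≢ j → i ≢ l → j ≢ l → gram (seidel t) i j * gram (seidel t) i l * gram (seidel t) j l ≡ triangleSign (n % 4)
          triangle i≢j i≢l j≢l = signs-triangle n (signs i≢j) (signs i≢l) (signs j≢l) (gram-triangle i≢j i≢l j≢l)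
        from : n % 4 ≡ 3 × DeletedSkewConference n (seidel t) → pred-squares ≡ 0ℤ
        from (_ , deleted-conference) = offdiag-sum-vanishes λ i≢j →
          cong (_- 1ℤ) (isSign-square (deleted⇒gram-sign deleted-conference i≢j))

      odd-case : 96 ℕ.* diamonds t ≤ n ℕ.* (n ∸ 1) ℕ.* (n ∸ 3) ℕ.* (n ℕ.+ 1)
        × (96 ℕ.* diamonds t ≡ n ℕ.* (n ∸ 1) ℕ.* (n ∸ 3) ℕ.* (n ℕ.+ 1) ⇔ (n % 4 ≡ 3 × DeletedSkewConference n (seidel t)))
      odd-case = map₂ (λ equality → pred-squares-zero⇔deleted ⇔-∘ (nonneg-zero⇔ pred-squares-nonneg ⇔-∘ equality))
                      (bound-and-equality {r = proj₁ pred-squares-nonneg} odd-count)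

open import Data.Nat using (_+_; _*_; _∸_; _≤_; _%_)
open import Function.Bundles using (_⇔_)
open DiamondBound using (even-case; odd-case)

theorem1 : (n : ℕ) → 3 ≤ n → (t : Tournament n) →
    ((n % 2 ≡ 0) →
      (96 * diamonds t ≤ n * n * (n ∸ 1) * (n ∸ 2))
      × ((96 * diamonds t ≡ n * n * (n ∸ 1) * (n ∸ 2))
          ⇔ ((n % 4 ≡ 0) × IsSkewConference n (seidel t))))
    × ((n % 2 ≡ 1) →
      (96 * diamonds t ≤ n * (n ∸ 1) * (n ∸ 3) * (n + 1))
      × ((96 * diamonds t ≡ n * (n ∸ 1) * (n ∸ 3) * (n + 1))
          ⇔ ((n % 4 ≡ 3) × DeletedSkewConference n (seidel t))))
-- The even-order statement holds for every n: for odd n both sides of its equivalence fail.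
theorem1 n 3≤n t = (λ _ → even-case t 3≤n) , odd-case t 3≤n
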